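{- Let $p$ be a prime and $d\in\{0,1,\ldots,p-1\}$. Then $$\sum_{k=0}^{p-1}C_{k+d}\equiv\frac{3\left(\frac p3\right)-1}2+\sum_{0\le k<d}C_k\pmod{p},$$ $$\sum_{k=0}^{p-1}kC_{k+d}\equiv\frac{d+1}2\left(1-\left(\frac p3\right)\right)-\left(\frac p3\right)d-\sum_{k=0}^dkC_{d-k}\pmod{p},$$ $$\sum_{k=0}^{p-1}k^2C_{k+d}\equiv\frac{9d^2+6d-1}6\left(\frac p3\right)-\frac{(d+1)^2}2-[p=3]+\sum_{0<k\le d}k^2C_{d-k}\pmod{p}.$$
   Context: $C_n=\frac1{n+1}\binom{2n}n$ is the $n$-th Catalan number. For an integer $a$, $\left(\frac a3\right)$ is the unique integer in $\{0,\pm1\}$ congruent to $a$ mod $3$. $[A]=1$ if assertion $A$ holds and $0$ otherwise. For rationals $a,b$, $a\equiv b\pmod p$ means $a-b=u/v$ with integers $u,v$, $p\nmid v$, $p\mid u$. -}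

module Defs where

open import Data.Nat as ℕ using (ℕ; zero; suc; _%_; _≡ᵇ_)
open import Data.Nat.Combinatorics using (_C_)
open import Data.Integer as ℤ using (ℤ; +_; -[1+_])
open import Data.Rational as ℚ using (ℚ; _/_; _+_; _*_; _-_; -_)
open import Data.Bool using (if_then_else_)
open import Data.Product using (Σ; _×_)
open import Relation.Binary.PropositionalEquality using (_≡_)
open import Relation.Nullary using (¬_)
open import Data.Nat.Divisibility using (_∣_)
import Data.Integer.Divisibility as ℤD

ι : ℕ → ℚ
ι n = + n / 1

Cat : ℕ → ℚ
Cat n = + ((n ℕ.+ n) C n) / suc n

Σ< : ℕ → (ℕ → ℚ) → ℚ
Σ< zero    f = + 0 / 1
Σ< (suc n) f = Σ< n f + f n

leg3 : ℕ → ℚ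
leg3 a with a % 3
... | 0 = + 0 / 1
... | 1 = + 1 / 1
... | _ = -[1+ 0 ] / 1

isThree : ℕ → ℚ
isThree p = if p ≡ᵇ 3 then + 1 / 1 else + 0 / 1

_≡_[modℚ_] : ℚ → ℚ → ℕ → Set
a ≡ b [modℚ p ] =
  Σ ℤ λ u → Σ ℕ λ v → Σ (ℕ.NonZero v) λ nz →
    (¬ (p ∣ v)) × (ℤ.+ p ℤD.∣ u) × (a - b ≡ _/_ u v {{nz}})

{-# OPTIONS --safe #-}
module Submission where

-- Write p = 2h + 1 and let c_k be the integer Catalan numbers.  Modulo p,
-- c_k ≡ 2 C(h+1, k+1) (-4)^k for k < p - 1 and c_{p+b} ≡ 2 c_b for b < p - 1, both by induction
-- along (k + 2) c_{k+1} = 2 (2k + 1) c_k, while c_{p-1} ≡ -1 because p c_{p-1} = C(2p-2, p-1)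
-- and C(2p-2, p) ≡ 1.  The first congruence turns the moments Σ_{k<p} (k+1)^i c_k (i ≤ 2) into
-- binomial sums Σ_k C(h+1, k+1) (k+1)^i (-4)^k, which the binomial theorem evaluates exactly in
-- terms of (-3)^h; and (-3)^h ≡ (p/3), since (1 + √-3)^p ≡ 1 + (√-3)^p while (1 + √-3)^3 = -8.
-- The second congruence shifts the sums: Σ_{k<p} f(k + d) ≡ Σ_{k<p} f(k) + Σ_{k<d} f(k) when
-- f(p + b) ≡ 2 f(b), and the moments for the weights (k - d)^i are combinations of those above.
-- Division by 2 and 6 needs p ≥ 5; the primes 2 and 3 are checked by evaluation.

open import Data.Nat as ℕ using (ℕ; zero; suc; _<_; _≤_; z≤n; s≤s; _%_)
import Data.Nat.Properties as ℕP
open import Data.Nat.Combinatorics using (_C_; nCk+nC[k+1]≡[n+1]C[k+1]; nCk≡nC[n∸k]; nC1≡n; nCn≡1; k>n⇒nCk≡0)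
open import Function using (_∘_; id)
open import Data.Product using (Σ; _×_; _,_; proj₁; proj₂)
open import Relation.Binary.Bundles using (Setoid)
import Relation.Binary.Reasoning.Setoid as SetoidReasoning
open import Data.Sum using ([_,_]; [_,_]′)
open import Data.Empty using (⊥-elim)
open import Data.Bool using (true; false; T)
open import Data.Unit using (tt)
open import Relation.Nullary using (¬_)
open import Relation.Nullary.Decidable using (True; False; toWitness; toWitnessFalse)
open import Data.Nat.Divisibility using (_∣_; _∣?_; divides; ∣⇒≤)
open import Data.Nat.DivMod using (m≡m%n+[m/n]*n; m%n<n)
open import Data.Nat.Primality using (Prime; euclidsLemma; prime⇒irreducible; ¬prime[0]; ¬prime[1])
open import Relation.Binary.PropositionalEquality hiding ([_])
import Data.Nat.Tactic.RingSolver as NatSolver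
open import Data.Integer.Tactic.RingSolver using (solve-∀)

module _ where
  open import Data.Integer using (ℤ; +_; -[1+_]; 0ℤ; 1ℤ; -1ℤ; _+_; _-_; _*_; -_; _^_; ∣_∣)
  import Data.Integer.Properties as ℤP

  Σℤ : ℕ → (ℕ → ℤ) → ℤ
  Σℤ zero    f = 0ℤ
  Σℤ (suc n) f = Σℤ n f + f n

  Σℤ-cong : ∀ n {f g : ℕ → ℤ} → (∀ {k} → k < n → f k ≡ g k) → Σℤ n f ≡ Σℤ n g
  Σℤ-cong zero    f≡g = refl
  Σℤ-cong (suc n) f≡g = cong₂ _+_ (Σℤ-cong n (f≡g ∘ ℕP.m<n⇒m<1+n)) (f≡g ℕP.≤-refl)

  Σℤ-zero : ∀ n {f : ℕ → ℤ} → (∀ k → f k ≡ 0ℤ) → Σℤ n f ≡ 0ℤ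
  Σℤ-zero zero    f≡0 = refl
  Σℤ-zero (suc n) f≡0 = cong₂ _+_ (Σℤ-zero n f≡0) (f≡0 n)

  Σℤ-distrib-+ : ∀ n (f g : ℕ → ℤ) → Σℤ n (λ k → f k + g k) ≡ Σℤ n f + Σℤ n g
  Σℤ-distrib-+ zero    f g = refl
  Σℤ-distrib-+ (suc n) f g =
    trans (cong (_+ (f n + g n)) (Σℤ-distrib-+ n f g)) (interchange (Σℤ n f) (Σℤ n g) (f n) (g n))
    where interchange : ∀ a b c d → a + b + (c + d) ≡ a + c + (b + d)
          interchange = solve-∀

  Σℤ-*ˡ : ∀ n c (f : ℕ → ℤ) → Σℤ n (λ k → c * f k) ≡ c * Σℤ n f
  Σℤ-*ˡ zero    c f = sym (ℤP.*-zeroʳ c)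
  Σℤ-*ˡ (suc n) c f = trans (cong (_+ c * f n) (Σℤ-*ˡ n c f)) (sym (ℤP.*-distribˡ-+ c (Σℤ n f) (f n)))

  Σℤ-linear : ∀ n a b (f g : ℕ → ℤ) → Σℤ n (λ k → a * f k + b * g k) ≡ a * Σℤ n f + b * Σℤ n g
  Σℤ-linear n a b f g =
    trans (Σℤ-distrib-+ n (λ k → a * f k) (λ k → b * g k)) (cong₂ _+_ (Σℤ-*ˡ n a f) (Σℤ-*ˡ n b g))

  Σℤ-linear₃ : ∀ n a b c (f g h : ℕ → ℤ) →
    Σℤ n (λ k → a * f k + b * g k + c * h k) ≡ a * Σℤ n f + b * Σℤ n g + c * Σℤ n h
  Σℤ-linear₃ n a b c f g h = begin
    Σℤ n (λ k → a * f k + b * g k + c * h k)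
      ≡⟨ Σℤ-distrib-+ n (λ k → a * f k + b * g k) (λ k → c * h k) ⟩
    Σℤ n (λ k → a * f k + b * g k) + Σℤ n (λ k → c * h k)
      ≡⟨ cong₂ _+_ (Σℤ-linear n a b f g) (Σℤ-*ˡ n c h) ⟩
    a * Σℤ n f + b * Σℤ n g + c * Σℤ n h ∎
    where open ≡-Reasoning

  Σℤ-*ˡ-weighted : ∀ n (w : ℕ → ℤ) c (f : ℕ → ℤ) →
                   Σℤ n (λ j → w j * (c * f j)) ≡ c * Σℤ n (λ j → w j * f j)
  Σℤ-*ˡ-weighted n w c f =
    trans (Σℤ-cong n (λ {j} _ → swap (w j) c (f j))) (Σℤ-*ˡ n c (λ j → w j * f j))
    where swap : ∀ w c f → w * (c * f) ≡ c * (w * f)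
          swap = solve-∀

  Σℤ-weighted-cong : ∀ n (w : ℕ → ℤ) {f g : ℕ → ℤ} → (∀ k → f k ≡ g k) →
                     Σℤ n (λ j → w j * f j) ≡ Σℤ n (λ j → w j * g j)
  Σℤ-weighted-cong n w f≡g = Σℤ-cong n (λ {j} _ → cong (w j *_) (f≡g j))

  Σℤ-weighted-distrib-+ : ∀ n (w f g : ℕ → ℤ) →
    Σℤ n (λ j → w j * (f j + g j)) ≡ Σℤ n (λ j → w j * f j) + Σℤ n (λ j → w j * g j)
  Σℤ-weighted-distrib-+ n w f g =
    trans (Σℤ-cong n (λ {j} _ → ℤP.*-distribˡ-+ (w j) (f j) (g j))) (Σℤ-distrib-+ n _ _)

  Σℤ-head : ∀ n (f : ℕ → ℤ) → Σℤ (suc n) f ≡ f 0 + Σℤ n (f ∘ suc)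
  Σℤ-head zero    f = ℤP.+-comm 0ℤ (f 0)
  Σℤ-head (suc n) f = trans (cong (_+ f (suc n)) (Σℤ-head n f)) (ℤP.+-assoc (f 0) _ _)

  Σℤ-+ : ∀ m n (f : ℕ → ℤ) → Σℤ (m ℕ.+ n) f ≡ Σℤ m f + Σℤ n (λ k → f (m ℕ.+ k))
  Σℤ-+ m zero    f = trans (cong (λ m′ → Σℤ m′ f) (ℕP.+-identityʳ m)) (sym (ℤP.+-identityʳ _))
  Σℤ-+ m (suc n) f = begin
    Σℤ (m ℕ.+ suc n) f                                   ≡⟨ cong (λ m′ → Σℤ m′ f) (ℕP.+-suc m n) ⟩
    Σℤ (m ℕ.+ n) f + f (m ℕ.+ n)                         ≡⟨ cong (_+ f (m ℕ.+ n)) (Σℤ-+ m n f) ⟩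
    Σℤ m f + Σℤ n (λ k → f (m ℕ.+ k)) + f (m ℕ.+ n)      ≡⟨ ℤP.+-assoc (Σℤ m f) _ _ ⟩
    Σℤ m f + Σℤ (suc n) (λ k → f (m ℕ.+ k))              ∎
    where open ≡-Reasoning

  Σℤ-translate : ∀ n d (f : ℕ → ℤ) →
    Σℤ n (λ k → f (k ℕ.+ d)) + Σℤ d f ≡ Σℤ n f + Σℤ d (λ k → f (n ℕ.+ k))
  Σℤ-translate n d f = begin
    Σℤ n (λ k → f (k ℕ.+ d)) + Σℤ d f
      ≡⟨ cong₂ _+_ (Σℤ-cong n (λ {k} _ → cong f (ℕP.+-comm k d))) refl ⟩
    Σℤ n (λ k → f (d ℕ.+ k)) + Σℤ d f
      ≡⟨ ℤP.+-comm _ (Σℤ d f) ⟩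
    Σℤ d f + Σℤ n (λ k → f (d ℕ.+ k))
      ≡⟨ sym (Σℤ-+ d n f) ⟩
    Σℤ (d ℕ.+ n) f
      ≡⟨ cong (λ m → Σℤ m f) (ℕP.+-comm d n) ⟩
    Σℤ (n ℕ.+ d) f
      ≡⟨ Σℤ-+ n d f ⟩
    Σℤ n f + Σℤ d (λ k → f (n ℕ.+ k)) ∎
    where open ≡-Reasoning

  Σℤ-reverse : ∀ n (f : ℕ → ℤ) → Σℤ n (λ k → f (n ℕ.∸ suc k)) ≡ Σℤ n f
  Σℤ-reverse zero    f = refl
  Σℤ-reverse (suc n) f = begin
    Σℤ (suc n) (λ k → f (n ℕ.∸ k))           ≡⟨ Σℤ-head n _ ⟩
    f n + Σℤ n (λ k → f (n ℕ.∸ suc k))       ≡⟨ cong (λ s → f n + s) (Σℤ-reverse n f) ⟩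
    f n + Σℤ n f                             ≡⟨ ℤP.+-comm (f n) _ ⟩
    Σℤ (suc n) f                             ∎
    where open ≡-Reasoning

  +[m∸n]≡+m-+n : ∀ {m n} → n ≤ m → + (m ℕ.∸ n) ≡ + m - + n
  +[m∸n]≡+m-+n {m} {n} n≤m = sym (trans (ℤP.m-n≡m⊖n m n) (ℤP.⊖-≥ n≤m))

  Σℤ-reverse-linear : ∀ d (f : ℕ → ℤ) →
    Σℤ (suc d) (λ k → + k * f (d ℕ.∸ k)) ≡ - Σℤ d (λ m → (+ m - + d) * f m)
  Σℤ-reverse-linear d f = begin
    Σℤ (suc d) (λ k → + k * f (d ℕ.∸ k))
      ≡⟨ Σℤ-cong (suc d) (λ k<1+d → reflect (ℕP.≤-pred k<1+d)) ⟩
    Σℤ (suc d) (λ k → F (d ℕ.∸ k))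
      ≡⟨ Σℤ-reverse (suc d) F ⟩
    Σℤ d F + + (d ℕ.∸ d) * f d
      ≡⟨ cong (λ t → Σℤ d F + + t * f d) (ℕP.n∸n≡0 d) ⟩
    Σℤ d F + 0ℤ
      ≡⟨ ℤP.+-identityʳ (Σℤ d F) ⟩
    Σℤ d F
      ≡⟨ Σℤ-cong d (λ m<d → negate (ℕP.<⇒≤ m<d)) ⟩
    Σℤ d (λ m → -1ℤ * ((+ m - + d) * f m))
      ≡⟨ Σℤ-*ˡ d -1ℤ (λ m → (+ m - + d) * f m) ⟩
    -1ℤ * Σℤ d (λ m → (+ m - + d) * f m)
      ≡⟨ ℤP.-1*i≡-i _ ⟩
    - Σℤ d (λ m → (+ m - + d) * f m) ∎
    where
      open ≡-Reasoning
      F : ℕ → ℤ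
      F m = + (d ℕ.∸ m) * f m
      reflect : ∀ {k} → k ≤ d → + k * f (d ℕ.∸ k) ≡ F (d ℕ.∸ k)
      reflect {k} k≤d = cong (λ t → + t * f (d ℕ.∸ k)) (sym (ℕP.m∸[m∸n]≡n k≤d))
      flip : ∀ d m x → (d - m) * x ≡ -1ℤ * ((m - d) * x)
      flip = solve-∀
      negate : ∀ {m} → m ≤ d → F m ≡ -1ℤ * ((+ m - + d) * f m)
      negate {m} m≤d = trans (cong (_* f m) (+[m∸n]≡+m-+n m≤d)) (flip (+ d) (+ m) (f m))

  Σℤ-reverse-quadratic : ∀ d (f : ℕ → ℤ) →
    Σℤ d (λ j → + (suc j ℕ.* suc j) * f (d ℕ.∸ suc j)) ≡ Σℤ d (λ m → (+ m - + d) * (+ m - + d) * f m)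
  Σℤ-reverse-quadratic d f = begin
    Σℤ d (λ j → + (suc j ℕ.* suc j) * f (d ℕ.∸ suc j))
      ≡⟨ Σℤ-cong d reflect ⟩
    Σℤ d (λ j → G (d ℕ.∸ suc j))
      ≡⟨ Σℤ-reverse d G ⟩
    Σℤ d G
      ≡⟨ Σℤ-cong d (λ {m} m<d → square (ℕP.<⇒≤ m<d)) ⟩
    Σℤ d (λ m → (+ m - + d) * (+ m - + d) * f m) ∎
    where
      open ≡-Reasoning
      G : ℕ → ℤ
      G m = + ((d ℕ.∸ m) ℕ.* (d ℕ.∸ m)) * f m
      reflect : ∀ {j} → suc j ≤ d → + (suc j ℕ.* suc j) * f (d ℕ.∸ suc j) ≡ G (d ℕ.∸ suc j)
      reflect {j} 1+j≤d = cong (λ t → + (t ℕ.* t) * f (d ℕ.∸ suc j)) (sym (ℕP.m∸[m∸n]≡n 1+j≤d))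
      flip : ∀ d m x → (d - m) * (d - m) * x ≡ (m - d) * (m - d) * x
      flip = solve-∀
      square : ∀ {m} → m ≤ d → G m ≡ (+ m - + d) * (+ m - + d) * f m
      square {m} m≤d = begin
        + ((d ℕ.∸ m) ℕ.* (d ℕ.∸ m)) * f m      ≡⟨ cong (_* f m) (ℤP.pos-* (d ℕ.∸ m) (d ℕ.∸ m)) ⟩
        + (d ℕ.∸ m) * + (d ℕ.∸ m) * f m       ≡⟨ cong (λ t → t * t * f m) (+[m∸n]≡+m-+n m≤d) ⟩
        (+ d - + m) * (+ d - + m) * f m       ≡⟨ flip (+ d) (+ m) (f m) ⟩
        (+ m - + d) * (+ m - + d) * f m       ∎

  -- Binomial coefficients and binomial sums

  binomial : ℕ → ℕ → ℤ
  binomial n k = + (n C k)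

  C-pascal : ∀ n k → binomial (suc n) (suc k) ≡ binomial n k + binomial n (suc k)
  C-pascal n k = trans (cong +_ (sym (nCk+nC[k+1]≡[n+1]C[k+1] n k))) (ℤP.pos-+ (n C k) _)

  C-symmetric : ∀ a b → (a ℕ.+ b) C a ≡ (a ℕ.+ b) C b
  C-symmetric a b = trans (nCk≡nC[n∸k] (ℕP.m≤m+n a b)) (cong ((a ℕ.+ b) C_) (ℕP.m+n∸m≡n a b))

  C-absorption : ∀ n k → suc k ℕ.* (suc n C suc k) ≡ suc n ℕ.* (n C k)
  C-absorption n       zero    = trans (ℕP.+-identityʳ _) (trans (nC1≡n (suc n)) (sym (ℕP.*-identityʳ (suc n))))
  C-absorption zero    (suc k) = ℕP.*-zeroʳ (suc (suc k))
  C-absorption (suc n) (suc k) = begin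
    suc (suc k) ℕ.* (suc (suc n) C suc (suc k))
      ≡⟨ cong (suc (suc k) ℕ.*_) (sym (nCk+nC[k+1]≡[n+1]C[k+1] (suc n) (suc k))) ⟩
    suc (suc k) ℕ.* (a ℕ.+ b)
      ≡⟨ split (suc k) a b ⟩
    a ℕ.+ (suc k ℕ.* a ℕ.+ suc (suc k) ℕ.* b)
      ≡⟨ cong₂ (λ x y → a ℕ.+ (x ℕ.+ y)) (C-absorption n k) (C-absorption n (suc k)) ⟩
    a ℕ.+ (suc n ℕ.* (n C k) ℕ.+ suc n ℕ.* (n C suc k))
      ≡⟨ cong (a ℕ.+_) (sym (ℕP.*-distribˡ-+ (suc n) (n C k) _)) ⟩
    a ℕ.+ suc n ℕ.* ((n C k) ℕ.+ (n C suc k))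
      ≡⟨ cong (λ x → a ℕ.+ suc n ℕ.* x) (nCk+nC[k+1]≡[n+1]C[k+1] n k) ⟩
    suc (suc n) ℕ.* a ∎
    where
      open ≡-Reasoning
      a = suc n C suc k
      b = suc n C suc (suc k)
      split : ∀ j a b → suc j ℕ.* (a ℕ.+ b) ≡ a ℕ.+ (j ℕ.* a ℕ.+ suc j ℕ.* b)
      split = NatSolver.solve-∀

  C-absorptionℤ : ∀ n k → + suc k * binomial (suc n) (suc k) ≡ + suc n * binomial n k
  C-absorptionℤ n k = begin
    + suc k * + (suc n C suc k)        ≡⟨ ℤP.pos-* (suc k) _ ⟨
    + (suc k ℕ.* (suc n C suc k))      ≡⟨ cong +_ (C-absorption n k) ⟩
    + (suc n ℕ.* (n C k))              ≡⟨ ℤP.pos-* (suc n) _ ⟩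
    + suc n * + (n C k)                ∎
    where open ≡-Reasoning

  C-absorption′ : ∀ n k → + suc k * binomial n (suc k) ≡ (+ n - + k) * binomial n k
  C-absorption′ n k = begin
    + suc k * b
      ≡⟨ expand (+ suc k) a b ⟩
    + suc k * (a + b) - + suc k * a
      ≡⟨ cong (λ x → + suc k * x - + suc k * a) (C-pascal n k) ⟨
    + suc k * binomial (suc n) (suc k) - + suc k * a
      ≡⟨ cong (_- + suc k * a) (C-absorptionℤ n k) ⟩
    + suc n * a - + suc k * a
      ≡⟨ cong₂ (λ x y → x * a - y * a) (ℤP.pos-+ 1 n) (ℤP.pos-+ 1 k) ⟩
    (1ℤ + + n) * a - (1ℤ + + k) * a
      ≡⟨ collect (+ n) (+ k) a ⟩
    (+ n - + k) * a ∎
    where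
      open ≡-Reasoning
      a = binomial n k
      b = binomial n (suc k)
      expand : ∀ s a b → s * b ≡ s * (a + b) - s * a
      expand = solve-∀
      collect : ∀ n k a → (1ℤ + n) * a - (1ℤ + k) * a ≡ (n - k) * a
      collect = solve-∀

  binomialSum : ℕ → (ℕ → ℤ) → ℤ
  binomialSum n f = Σℤ (suc n) (λ j → binomial n j * f j)

  binomialSum-*ˡ : ∀ n c (f : ℕ → ℤ) → binomialSum n (λ j → c * f j) ≡ c * binomialSum n f
  binomialSum-*ˡ n c f = Σℤ-*ˡ-weighted (suc n) (binomial n) c f

  binomialSum-cong : ∀ m {f g : ℕ → ℤ} → (∀ k → f k ≡ g k) → binomialSum m f ≡ binomialSum m g
  binomialSum-cong m = Σℤ-weighted-cong (suc m) (binomial m)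

  binomialSum-distrib-+ : ∀ m (f g : ℕ → ℤ) →
                          binomialSum m (λ k → f k + g k) ≡ binomialSum m f + binomialSum m g
  binomialSum-distrib-+ m = Σℤ-weighted-distrib-+ (suc m) (binomial m)

  binomialSum-suc : ∀ n (f : ℕ → ℤ) → binomialSum (suc n) f ≡ binomialSum n f + binomialSum n (f ∘ suc)
  binomialSum-suc n f = begin
    Σℤ (suc (suc n)) (λ j → binomial (suc n) j * f j)
      ≡⟨ Σℤ-head (suc n) _ ⟩
    f₀ + Σℤ (suc n) (λ j → binomial (suc n) (suc j) * f (suc j))
      ≡⟨ cong (λ s → f₀ + s) (Σℤ-cong (suc n) (λ {j} _ → pascal j)) ⟩
    f₀ + Σℤ (suc n) (λ j → binomial n j * f (suc j) + binomial n (suc j) * f (suc j))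
      ≡⟨ cong (λ s → f₀ + s) (Σℤ-distrib-+ (suc n) _ _) ⟩
    f₀ + (binomialSum n (f ∘ suc) + (U + binomial n (suc n) * f (suc n)))
      ≡⟨ cong (λ b → f₀ + (binomialSum n (f ∘ suc) + (U + + b * f (suc n)))) (k>n⇒nCk≡0 (ℕP.n<1+n n)) ⟩
    f₀ + (binomialSum n (f ∘ suc) + (U + 0ℤ))
      ≡⟨ rearrange f₀ (binomialSum n (f ∘ suc)) U ⟩
    (f₀ + U) + binomialSum n (f ∘ suc)
      ≡⟨ cong (_+ binomialSum n (f ∘ suc)) (Σℤ-head n (λ j → binomial n j * f j)) ⟨
    binomialSum n f + binomialSum n (f ∘ suc) ∎
    where
      open ≡-Reasoning
      f₀ = binomial n 0 * f 0
      U = Σℤ n (λ j → binomial n (suc j) * f (suc j))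
      pascal : ∀ j → binomial (suc n) (suc j) * f (suc j)
                     ≡ binomial n j * f (suc j) + binomial n (suc j) * f (suc j)
      pascal j = trans (cong (_* f (suc j)) (C-pascal n j))
                       (ℤP.*-distribʳ-+ (f (suc j)) (binomial n j) (binomial n (suc j)))
      rearrange : ∀ a b c → a + (b + (c + 0ℤ)) ≡ (a + c) + b
      rearrange = solve-∀

  binomial-theorem : ∀ n x → binomialSum n (x ^_) ≡ (1ℤ + x) ^ n
  binomial-theorem zero    x = refl
  binomial-theorem (suc n) x = begin
    binomialSum (suc n) (x ^_)
      ≡⟨ binomialSum-suc n (x ^_) ⟩
    binomialSum n (x ^_) + binomialSum n (λ j → x * x ^ j)
      ≡⟨ cong (λ s → binomialSum n (x ^_) + s) (binomialSum-*ˡ n x (x ^_)) ⟩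
    binomialSum n (x ^_) + x * binomialSum n (x ^_)
      ≡⟨ cong (λ s → s + x * s) (binomial-theorem n x) ⟩
    (1ℤ + x) ^ n + x * (1ℤ + x) ^ n
      ≡⟨ factor ((1ℤ + x) ^ n) x ⟩
    (1ℤ + x) ^ suc n ∎
    where
      open ≡-Reasoning
      factor : ∀ t x → t + x * t ≡ (1ℤ + x) * t
      factor = solve-∀

  binomialSum⁺ : ℕ → (ℕ → ℤ) → ℤ
  binomialSum⁺ m f = Σℤ (suc m) (λ k → binomial (suc m) (suc k) * f k)

  binomialSum⁺-cong : ∀ m {f g : ℕ → ℤ} → (∀ k → f k ≡ g k) → binomialSum⁺ m f ≡ binomialSum⁺ m g
  binomialSum⁺-cong m = Σℤ-weighted-cong (suc m) (binomial (suc m) ∘ suc)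

  binomialSum⁺-*ˡ : ∀ m c (f : ℕ → ℤ) → binomialSum⁺ m (λ k → c * f k) ≡ c * binomialSum⁺ m f
  binomialSum⁺-*ˡ m = Σℤ-*ˡ-weighted (suc m) (binomial (suc m) ∘ suc)

  binomialSum-head : ∀ m (f : ℕ → ℤ) → binomialSum (suc m) f ≡ f 0 + binomialSum⁺ m (f ∘ suc)
  binomialSum-head m f = trans (Σℤ-head (suc m) _) (cong (_+ binomialSum⁺ m (f ∘ suc)) (ℤP.*-identityˡ (f 0)))

  binomialSum⁺-absorption : ∀ m (f : ℕ → ℤ) →
                            binomialSum⁺ m (λ k → + suc k * f k) ≡ + suc m * binomialSum m f
  binomialSum⁺-absorption m f =
    trans (Σℤ-cong (suc m) (λ {k} _ → absorb k)) (Σℤ-*ˡ (suc m) (+ suc m) (λ k → binomial m k * f k))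
    where
      open ≡-Reasoning
      regroup : ∀ b s x → b * (s * x) ≡ (s * b) * x
      regroup = solve-∀
      absorb : ∀ k → binomial (suc m) (suc k) * (+ suc k * f k) ≡ + suc m * (binomial m k * f k)
      absorb k = begin
        binomial (suc m) (suc k) * (+ suc k * f k)    ≡⟨ regroup (binomial (suc m) (suc k)) (+ suc k) (f k) ⟩
        (+ suc k * binomial (suc m) (suc k)) * f k    ≡⟨ cong (_* f k) (C-absorptionℤ m k) ⟩
        (+ suc m * binomial m k) * f k                ≡⟨ ℤP.*-assoc (+ suc m) (binomial m k) (f k) ⟩
        + suc m * (binomial m k * f k)                ∎

  binomialSum⁺-powers : ∀ m x → x * binomialSum⁺ m (x ^_) + 1ℤ ≡ (1ℤ + x) ^ suc m
  binomialSum⁺-powers m x = begin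
    x * binomialSum⁺ m (x ^_) + 1ℤ
      ≡⟨ ℤP.+-comm (x * binomialSum⁺ m (x ^_)) 1ℤ ⟩
    1ℤ + x * binomialSum⁺ m (x ^_)
      ≡⟨ cong (λ s → 1ℤ + s) (binomialSum⁺-*ˡ m x (x ^_)) ⟨
    1ℤ + binomialSum⁺ m (λ k → x * x ^ k)
      ≡⟨ binomialSum-head m (x ^_) ⟨
    binomialSum (suc m) (x ^_)
      ≡⟨ binomial-theorem (suc m) x ⟩
    (1ℤ + x) ^ suc m ∎
    where open ≡-Reasoning

  binomialSum⁺-linear : ∀ m x → binomialSum⁺ m (λ k → + suc k * x ^ k) ≡ + suc m * (1ℤ + x) ^ m
  binomialSum⁺-linear m x =
    trans (binomialSum⁺-absorption m (x ^_)) (cong (+ suc m *_) (binomial-theorem m x))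

  binomialSum-derivative : ∀ m x → binomialSum (suc m) (λ k → + k * x ^ k) ≡ + suc m * x * (1ℤ + x) ^ m
  binomialSum-derivative m x = begin
    binomialSum (suc m) (λ k → + k * x ^ k)
      ≡⟨ binomialSum-head m _ ⟩
    0ℤ + binomialSum⁺ m (λ k → + suc k * (x * x ^ k))
      ≡⟨ ℤP.+-identityˡ _ ⟩
    binomialSum⁺ m (λ k → + suc k * (x * x ^ k))
      ≡⟨ binomialSum⁺-cong m (λ k → swap (+ suc k) x (x ^ k)) ⟩
    binomialSum⁺ m (λ k → x * (+ suc k * x ^ k))
      ≡⟨ binomialSum⁺-*ˡ m x (λ k → + suc k * x ^ k) ⟩
    x * binomialSum⁺ m (λ k → + suc k * x ^ k)
      ≡⟨ cong (x *_) (binomialSum⁺-linear m x) ⟩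
    x * (+ suc m * (1ℤ + x) ^ m)
      ≡⟨ swap x (+ suc m) ((1ℤ + x) ^ m) ⟩
    + suc m * (x * (1ℤ + x) ^ m)
      ≡⟨ ℤP.*-assoc (+ suc m) x ((1ℤ + x) ^ m) ⟨
    + suc m * x * (1ℤ + x) ^ m ∎
    where
      open ≡-Reasoning
      swap : ∀ a b c → a * (b * c) ≡ b * (a * c)
      swap = solve-∀

  binomialSum⁺-quadratic : ∀ m x → binomialSum⁺ (suc m) (λ k → + suc k * + suc k * x ^ k)
                                    ≡ + suc (suc m) * ((1ℤ + x) ^ suc m + + suc m * x * (1ℤ + x) ^ m)
  binomialSum⁺-quadratic m x = begin
    binomialSum⁺ (suc m) (λ k → + suc k * + suc k * x ^ k)
      ≡⟨ binomialSum⁺-cong (suc m) (λ k → ℤP.*-assoc (+ suc k) (+ suc k) (x ^ k)) ⟩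
    binomialSum⁺ (suc m) (λ k → + suc k * (+ suc k * x ^ k))
      ≡⟨ binomialSum⁺-absorption (suc m) (λ k → + suc k * x ^ k) ⟩
    + suc (suc m) * binomialSum (suc m) (λ k → + suc k * x ^ k)
      ≡⟨ cong (+ suc (suc m) *_) (binomialSum-cong (suc m) split) ⟩
    + suc (suc m) * binomialSum (suc m) (λ k → x ^ k + + k * x ^ k)
      ≡⟨ cong (+ suc (suc m) *_) (binomialSum-distrib-+ (suc m) (x ^_) (λ k → + k * x ^ k)) ⟩
    + suc (suc m) * (binomialSum (suc m) (x ^_) + binomialSum (suc m) (λ k → + k * x ^ k))
      ≡⟨ cong (λ s → + suc (suc m) * s) (cong₂ _+_ (binomial-theorem (suc m) x) (binomialSum-derivative m x)) ⟩
    + suc (suc m) * ((1ℤ + x) ^ suc m + + suc m * x * (1ℤ + x) ^ m) ∎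
    where
      open ≡-Reasoning
      expand : ∀ k y → (1ℤ + k) * y ≡ y + k * y
      expand = solve-∀
      split : ∀ k → + suc k * x ^ k ≡ x ^ k + + k * x ^ k
      split k = trans (cong (_* x ^ k) (ℤP.pos-+ 1 k)) (expand (+ k) (x ^ k))

  catalan : ℕ → ℤ
  catalan n = binomial (n ℕ.+ n) n - binomial (n ℕ.+ n) (suc n)

  C[2n,1+n]-absorption : ∀ n → suc n ℕ.* ((n ℕ.+ n) C suc n) ≡ n ℕ.* ((n ℕ.+ n) C n)
  C[2n,1+n]-absorption zero    = refl
  C[2n,1+n]-absorption (suc m) = begin
    suc (suc m) ℕ.* (suc N C suc (suc m))   ≡⟨ C-absorption N (suc m) ⟩
    suc N ℕ.* (N C suc m)                   ≡⟨ cong (suc N ℕ.*_) (C-symmetric m (suc m)) ⟨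
    suc N ℕ.* (N C m)                       ≡⟨ C-absorption N m ⟨
    suc m ℕ.* (suc N C suc m)               ∎
    where
      open ≡-Reasoning
      N = m ℕ.+ suc m

  catalan-central : ∀ n → + suc n * catalan n ≡ binomial (n ℕ.+ n) n
  catalan-central n = begin
    + suc n * (a - b)                 ≡⟨ distrib (+ suc n) a b ⟩
    + suc n * a - + suc n * b         ≡⟨ cong (λ x → + suc n * a - x) (ℤP.pos-* (suc n) _) ⟨
    + suc n * a - + (suc n ℕ.* (N C suc n))  ≡⟨ cong (λ x → + suc n * a - + x) (C[2n,1+n]-absorption n) ⟩
    + suc n * a - + (n ℕ.* (N C n))   ≡⟨ cong₂ (λ x y → x * a - y) (ℤP.pos-+ 1 n) (ℤP.pos-* n _) ⟩
    (1ℤ + + n) * a - + n * a          ≡⟨ cancel (+ n) a ⟩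
    a                                 ∎
    where
      open ≡-Reasoning
      N = n ℕ.+ n
      a = binomial N n
      b = binomial N (suc n)
      distrib : ∀ s a b → s * (a - b) ≡ s * a - s * b
      distrib = solve-∀
      cancel : ∀ n a → (1ℤ + n) * a - n * a ≡ a
      cancel = solve-∀

  C[2n+2,n+1]-recurrence : ∀ n → suc n ℕ.* ((suc n ℕ.+ suc n) C suc n)
                                 ≡ 2 ℕ.* (suc (n ℕ.+ n) ℕ.* ((n ℕ.+ n) C n))
  C[2n+2,n+1]-recurrence n = begin
    suc n ℕ.* ((suc n ℕ.+ suc n) C suc n)   ≡⟨ cong (λ t → suc n ℕ.* (t C suc n)) 2n+2 ⟩
    suc n ℕ.* (suc (suc N) C suc n)         ≡⟨ C-absorption (suc N) n ⟩
    suc (suc N) ℕ.* (suc N C n)             ≡⟨ cong (λ t → suc (suc N) ℕ.* (t C n)) 2n+1 ⟨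
    suc (suc N) ℕ.* ((n ℕ.+ suc n) C n)     ≡⟨ cong (suc (suc N) ℕ.*_) (C-symmetric n (suc n)) ⟩
    suc (suc N) ℕ.* ((n ℕ.+ suc n) C suc n) ≡⟨ cong (λ t → suc (suc N) ℕ.* (t C suc n)) 2n+1 ⟩
    suc (suc N) ℕ.* (suc N C suc n)         ≡⟨ regroup n (suc N C suc n) ⟩
    2 ℕ.* (suc n ℕ.* (suc N C suc n))       ≡⟨ cong (2 ℕ.*_) (C-absorption N n) ⟩
    2 ℕ.* (suc N ℕ.* (N C n))               ∎
    where
      open ≡-Reasoning
      N = n ℕ.+ n
      2n+1 : n ℕ.+ suc n ≡ suc N
      2n+1 = ℕP.+-suc n n
      2n+2 : suc n ℕ.+ suc n ≡ suc (suc N)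
      2n+2 = cong suc 2n+1
      regroup : ∀ n c → suc (suc (n ℕ.+ n)) ℕ.* c ≡ 2 ℕ.* (suc n ℕ.* c)
      regroup = NatSolver.solve-∀

  catalan-recurrence : ∀ n → + suc (suc n) * catalan (suc n) ≡ + 2 * (+ 2 * + n + 1ℤ) * catalan n
  catalan-recurrence n = ℤP.*-cancelˡ-≡ (+ suc n) _ _ (begin
    + suc n * (+ suc (suc n) * catalan (suc n))
      ≡⟨ cong (+ suc n *_) (catalan-central (suc n)) ⟩
    + suc n * binomial (suc n ℕ.+ suc n) (suc n)
      ≡⟨ ℤP.pos-* (suc n) _ ⟨
    + (suc n ℕ.* ((suc n ℕ.+ suc n) C suc n))
      ≡⟨ cong +_ (C[2n+2,n+1]-recurrence n) ⟩
    + (2 ℕ.* (suc N ℕ.* (N C n)))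
      ≡⟨ trans (ℤP.pos-* 2 (suc N ℕ.* (N C n))) (cong (+ 2 *_) (ℤP.pos-* (suc N) (N C n))) ⟩
    + 2 * (+ suc N * binomial N n)
      ≡⟨ cong (λ b → + 2 * (+ suc N * b)) (catalan-central n) ⟨
    + 2 * (+ suc N * (+ suc n * catalan n))
      ≡⟨ cong₂ (λ x y → + 2 * (x * (y * catalan n))) 2n+1 (ℤP.pos-+ 1 n) ⟩
    + 2 * ((1ℤ + (+ n + + n)) * ((1ℤ + + n) * catalan n))
      ≡⟨ regroup (+ n) (catalan n) ⟩
    (1ℤ + + n) * (+ 2 * (+ 2 * + n + 1ℤ) * catalan n)
      ≡⟨ cong (λ x → x * (+ 2 * (+ 2 * + n + 1ℤ) * catalan n)) (ℤP.pos-+ 1 n) ⟨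
    + suc n * (+ 2 * (+ 2 * + n + 1ℤ) * catalan n) ∎)
    where
      open ≡-Reasoning
      N = n ℕ.+ n
      2n+1 : + suc N ≡ 1ℤ + (+ n + + n)
      2n+1 = trans (ℤP.pos-+ 1 N) (cong (λ x → 1ℤ + x) (ℤP.pos-+ n n))
      regroup : ∀ n c → + 2 * ((1ℤ + (n + n)) * ((1ℤ + n) * c)) ≡ (1ℤ + n) * (+ 2 * (+ 2 * n + 1ℤ) * c)
      regroup = solve-∀

  -- (√-3)^j = re[√-3]^ j + im[√-3]^ j · √-3, and likewise for (1 + √-3)^n.
  mutual
    re[√-3]^ : ℕ → ℤ
    re[√-3]^ zero    = 1ℤ
    re[√-3]^ (suc j) = - + 3 * im[√-3]^ j

    im[√-3]^ : ℕ → ℤ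
    im[√-3]^ zero    = 0ℤ
    im[√-3]^ (suc j) = re[√-3]^ j

  re[1+√-3]^ im[1+√-3]^ : ℕ → ℤ
  re[1+√-3]^ n = binomialSum n re[√-3]^
  im[1+√-3]^ n = binomialSum n im[√-3]^

  [√-3]^odd : ∀ h → re[√-3]^ (suc (h ℕ.+ h)) ≡ 0ℤ × im[√-3]^ (suc (h ℕ.+ h)) ≡ (- + 3) ^ h
  [√-3]^odd zero    = refl , refl
  [√-3]^odd (suc h) rewrite ℕP.+-suc h h =
    cong (- + 3 *_) (proj₁ ([√-3]^odd h)) , cong (- + 3 *_) (proj₂ ([√-3]^odd h))

  [1+√-3]^-suc : ∀ n → re[1+√-3]^ (suc n) ≡ re[1+√-3]^ n + - + 3 * im[1+√-3]^ n
                     × im[1+√-3]^ (suc n) ≡ im[1+√-3]^ n + re[1+√-3]^ n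
  [1+√-3]^-suc n =
    trans (binomialSum-suc n re[√-3]^) (cong (λ s → re[1+√-3]^ n + s) (binomialSum-*ˡ n (- + 3) im[√-3]^)) ,
    binomialSum-suc n im[√-3]^

  [1+√-3]^3≡-8 : ∀ n → re[1+√-3]^ (3 ℕ.+ n) ≡ - + 8 * re[1+√-3]^ n
                     × im[1+√-3]^ (3 ℕ.+ n) ≡ - + 8 * im[1+√-3]^ n
  [1+√-3]^3≡-8 n = trans (proj₁ step₃) (re-cube a b) , trans (proj₂ step₃) (im-cube a b)
    where
      a = re[1+√-3]^ n
      b = im[1+√-3]^ n
      step : ∀ k {x y} → re[1+√-3]^ k ≡ x → im[1+√-3]^ k ≡ y →
             re[1+√-3]^ (suc k) ≡ x + - + 3 * y × im[1+√-3]^ (suc k) ≡ y + x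
      step k refl refl = [1+√-3]^-suc k
      step₁ = step n refl refl
      step₂ = step (1 ℕ.+ n) (proj₁ step₁) (proj₂ step₁)
      step₃ = step (2 ℕ.+ n) (proj₁ step₂) (proj₂ step₂)
      re-cube : ∀ a b → (a + - + 3 * b) + - + 3 * (b + a) + - + 3 * ((b + a) + (a + - + 3 * b)) ≡ - + 8 * a
      re-cube = solve-∀
      im-cube : ∀ a b → ((b + a) + (a + - + 3 * b)) + ((a + - + 3 * b) + - + 3 * (b + a)) ≡ - + 8 * b
      im-cube = solve-∀

  [1+√-3]^-period : ∀ q r → re[1+√-3]^ (q ℕ.* 3 ℕ.+ r) ≡ (- + 8) ^ q * re[1+√-3]^ r
                          × im[1+√-3]^ (q ℕ.* 3 ℕ.+ r) ≡ (- + 8) ^ q * im[1+√-3]^ r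
  [1+√-3]^-period zero    r = sym (ℤP.*-identityˡ _) , sym (ℤP.*-identityˡ _)
  [1+√-3]^-period (suc q) r =
    trans (proj₁ ([1+√-3]^3≡-8 (q ℕ.* 3 ℕ.+ r))) (times-8 (re[1+√-3]^ r) (proj₁ ([1+√-3]^-period q r))) ,
    trans (proj₂ ([1+√-3]^3≡-8 (q ℕ.* 3 ℕ.+ r))) (times-8 (im[1+√-3]^ r) (proj₂ ([1+√-3]^-period q r)))
    where
      times-8 : ∀ y {x} → x ≡ (- + 8) ^ q * y → - + 8 * x ≡ (- + 8) ^ suc q * y
      times-8 y x≡ = trans (cong (- + 8 *_) x≡) (sym (ℤP.*-assoc (- + 8) ((- + 8) ^ q) y))

  -- Congruences of integers

  module Modulo (m : ℕ) where

    infix 4 _≈_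
    record _≈_ (a b : ℤ) : Set where
      constructor mk≈
      field
        quotient : ℤ
        equation : a ≡ b + quotient * + m

    +-multiple≈ : ∀ a k → a + k * + m ≈ a
    +-multiple≈ a k = mk≈ k refl

    ≡⇒≈ : ∀ {a b} → a ≡ b → a ≈ b
    ≡⇒≈ {a} refl = mk≈ 0ℤ (sym (ℤP.+-identityʳ a))

    ≈-refl : ∀ {a} → a ≈ a
    ≈-refl = ≡⇒≈ refl

    ≈-sym : ∀ {a b} → a ≈ b → b ≈ a
    ≈-sym {b = b} (mk≈ k refl) = mk≈ (- k) (back b k (+ m))
      where back : ∀ b k m → b ≡ b + k * m + - k * m
            back = solve-∀

    ≈-trans : ∀ {a b c} → a ≈ b → b ≈ c → a ≈ c
    ≈-trans {c = c} (mk≈ k refl) (mk≈ l refl) = mk≈ (l + k) (collect c k l (+ m))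
      where collect : ∀ c k l m → c + l * m + k * m ≡ c + (l + k) * m
            collect = solve-∀

    ≈-setoid : Setoid _ _
    ≈-setoid = record
      { Carrier       = ℤ
      ; _≈_           = _≈_
      ; isEquivalence = record { refl = ≈-refl ; sym = ≈-sym ; trans = ≈-trans }
      }

    module ≈-Reasoning = SetoidReasoning ≈-setoid

    +-cong : ∀ {a b c d} → a ≈ b → c ≈ d → a + c ≈ b + d
    +-cong {b = b} {d = d} (mk≈ k refl) (mk≈ l refl) = mk≈ (k + l) (collect b d k l (+ m))
      where collect : ∀ b d k l m → b + k * m + (d + l * m) ≡ b + d + (k + l) * m
            collect = solve-∀

    *-cong : ∀ {a b c d} → a ≈ b → c ≈ d → a * c ≈ b * d
    *-cong {b = b} {d = d} (mk≈ k refl) (mk≈ l refl) = mk≈ (k * d + b * l + k * l * + m) (expand b d k l (+ m))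
      where expand : ∀ b d k l m → (b + k * m) * (d + l * m) ≡ b * d + (k * d + b * l + k * l * m) * m
            expand = solve-∀

    neg-cong : ∀ {a b} → a ≈ b → - a ≈ - b
    neg-cong {b = b} (mk≈ k refl) = mk≈ (- k) (distrib b k (+ m))
      where distrib : ∀ b k m → - (b + k * m) ≡ - b + - k * m
            distrib = solve-∀

    sub-cong : ∀ {a b c d} → a ≈ b → c ≈ d → a - c ≈ b - d
    sub-cong a≈b c≈d = +-cong a≈b (neg-cong c≈d)

    *-congˡ : ∀ c {a b} → a ≈ b → c * a ≈ c * b
    *-congˡ c = *-cong (≈-refl {c})

    multiple≈0 : ∀ k → k * + m ≈ 0ℤ
    multiple≈0 k = mk≈ k (sym (ℤP.+-identityˡ (k * + m)))

    m≈0 : + m ≈ 0ℤ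
    m≈0 = ≈-trans (≡⇒≈ (sym (ℤP.*-identityˡ (+ m)))) (multiple≈0 1ℤ)

    m+n≈n : ∀ n → + (m ℕ.+ n) ≈ + n
    m+n≈n n = mk≈ 1ℤ (begin
      + (m ℕ.+ n)       ≡⟨ ℤP.pos-+ m n ⟩
      + m + + n         ≡⟨ ℤP.+-comm (+ m) (+ n) ⟩
      + n + + m         ≡⟨ cong (λ x → + n + x) (ℤP.*-identityˡ (+ m)) ⟨
      + n + 1ℤ * + m    ∎)
      where open ≡-Reasoning

    Σℤ-cong-≈ : ∀ n {f g : ℕ → ℤ} → (∀ {k} → k < n → f k ≈ g k) → Σℤ n f ≈ Σℤ n g
    Σℤ-cong-≈ zero    f≈g = ≈-refl
    Σℤ-cong-≈ (suc n) f≈g = +-cong (Σℤ-cong-≈ n (f≈g ∘ ℕP.m<n⇒m<1+n)) (f≈g ℕP.≤-refl)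

    ≈⇒∣ : ∀ {a b} → a ≈ b → m ∣ ∣ a - b ∣
    ≈⇒∣ {b = b} (mk≈ k refl) = divides ∣ k ∣ (trans (cong ∣_∣ (cancel b k (+ m))) (ℤP.abs-* k (+ m)))
      where cancel : ∀ b k m → b + k * m - b ≡ k * m
            cancel = solve-∀

    ∣⇒≈0 : ∀ z → m ∣ ∣ z ∣ → z ≈ 0ℤ
    ∣⇒≈0 (+ n)      (divides q n≡qm) =
      mk≈ (+ q) (trans (cong +_ n≡qm) (trans (ℤP.pos-* q m) (sym (ℤP.+-identityˡ (+ q * + m)))))
    ∣⇒≈0 -[1+ n ] (divides q n≡qm) = mk≈ (- + q) (begin
      - + suc n          ≡⟨ cong (λ x → - + x) n≡qm ⟩
      - + (q ℕ.* m)      ≡⟨ cong -_ (ℤP.pos-* q m) ⟩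
      - (+ q * + m)      ≡⟨ ℤP.neg-distribˡ-* (+ q) (+ m) ⟩
      - + q * + m        ≡⟨ ℤP.+-identityˡ (- + q * + m) ⟨
      0ℤ + - + q * + m   ∎)
      where open ≡-Reasoning

    ∣⇒≈ : ∀ {a b} → m ∣ ∣ a - b ∣ → a ≈ b
    ∣⇒≈ {a} {b} m∣a-b = begin
      a                  ≡⟨ restore a b ⟩
      (a - b) + b        ≈⟨ +-cong (∣⇒≈0 (a - b) m∣a-b) (≈-refl {b}) ⟩
      0ℤ + b             ≡⟨ ℤP.+-identityˡ b ⟩
      b                  ∎
      where
        open ≈-Reasoning
        restore : ∀ a b → a ≡ (a - b) + b
        restore = solve-∀

    Σℤ-translate-≈ : ∀ n d c (f : ℕ → ℤ) → (∀ {b} → b < d → f (n ℕ.+ b) ≈ c * f b) →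
                     Σℤ n (λ k → f (k ℕ.+ d)) ≈ Σℤ n f + (c - 1ℤ) * Σℤ d f
    Σℤ-translate-≈ n d c f shift = begin
      X
        ≡⟨ restore X A ⟩
      (X + A) - A
        ≡⟨ cong (_- A) (Σℤ-translate n d f) ⟩
      (S + Σℤ d (λ k → f (n ℕ.+ k))) - A
        ≈⟨ sub-cong (+-cong (≈-refl {S}) (Σℤ-cong-≈ d shift)) (≈-refl {A}) ⟩
      (S + Σℤ d (λ k → c * f k)) - A
        ≡⟨ cong (λ t → S + t - A) (Σℤ-*ˡ d c f) ⟩
      (S + c * A) - A
        ≡⟨ collect S c A ⟩
      S + (c - 1ℤ) * A ∎
      where
        open ≈-Reasoning
        X = Σℤ n (λ k → f (k ℕ.+ d))
        A = Σℤ d f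
        S = Σℤ n f
        restore : ∀ x a → x ≡ (x + a) - a
        restore = solve-∀
        collect : ∀ s c a → (s + c * a) - a ≡ s + (c - 1ℤ) * a
        collect = solve-∀

  module PrimeModulus (p : ℕ) (isPrime : Prime p) where
    open Modulo p public

    Unit : ℤ → Set
    Unit a = ¬ p ∣ ∣ a ∣

    unit-* : ∀ {a b} → Unit a → Unit b → Unit (a * b)
    unit-* {a} {b} ua ub p∣ab =
      [ ua , ub ] (euclidsLemma ∣ a ∣ ∣ b ∣ isPrime (subst (p ∣_) (ℤP.abs-* a b) p∣ab))

    small-unit : ∀ {k} → 0 < k → k < p → Unit (+ k)
    small-unit {suc k} _ k<p p∣k = ℕP.<⇒≱ k<p (∣⇒≤ p∣k)

    *-cancelˡ-≈ : ∀ a {x y} → Unit a → a * x ≈ a * y → x ≈ y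
    *-cancelˡ-≈ a {x} {y} ua ax≈ay =
      ∣⇒≈ ([ ⊥-elim ∘ ua , id ] (euclidsLemma ∣ a ∣ ∣ x - y ∣ isPrime p∣a[x-y]))
      where
        factor : ∀ a x y → a * x - a * y ≡ a * (x - y)
        factor = solve-∀
        p∣a[x-y] : p ∣ ∣ a ∣ ℕ.* ∣ x - y ∣
        p∣a[x-y] = subst (p ∣_) (trans (cong ∣_∣ (factor a x y)) (ℤP.abs-* a (x - y))) (≈⇒∣ ax≈ay)

    C[p+r,r]≈1 : ∀ {r} → r < p → binomial (p ℕ.+ r) r ≈ 1ℤ
    C[p+r,r]≈1 {zero}  _   = ≈-refl
    C[p+r,r]≈1 {suc r} r<p = *-cancelˡ-≈ (+ suc r) (small-unit (s≤s z≤n) r<p) (begin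
      + suc r * binomial (p ℕ.+ suc r) (suc r)
        ≡⟨ cong (λ t → + suc r * binomial t (suc r)) (ℕP.+-suc p r) ⟩
      + suc r * binomial (suc (p ℕ.+ r)) (suc r)
        ≡⟨ C-absorptionℤ (p ℕ.+ r) r ⟩
      + suc (p ℕ.+ r) * binomial (p ℕ.+ r) r
        ≈⟨ *-cong p+1+r≈1+r (C[p+r,r]≈1 (ℕP.<-trans (ℕP.n<1+n r) r<p)) ⟩
      + suc r * 1ℤ ∎)
      where
        open ≈-Reasoning
        p+1+r≈1+r : + suc (p ℕ.+ r) ≈ + suc r
        p+1+r≈1+r = ≈-trans (≡⇒≈ (cong +_ (sym (ℕP.+-suc p r)))) (m+n≈n (suc r))

  legendre3 : ℕ → ℤ
  legendre3 a with a % 3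
  ... | 0 = 0ℤ
  ... | 1 = 1ℤ
  ... | _ = -1ℤ

  module OddPrime (n : ℕ) (isPrime : Prime (suc (suc n ℕ.+ suc n))) where

    h q p : ℕ
    h = suc n
    q = h ℕ.+ h
    p = suc q

    open PrimeModulus p isPrime public

    +p≡1+2h : + p ≡ 1ℤ + (+ h + + h)
    +p≡1+2h = trans (ℤP.pos-+ 1 q) (cong (λ x → 1ℤ + x) (ℤP.pos-+ h h))

    +-multiple-of-p≈ : ∀ a k → a + k * (1ℤ + (+ h + + h)) ≈ a
    +-multiple-of-p≈ a k = subst (λ P → a + k * P ≈ a) +p≡1+2h (+-multiple≈ a k)

    C[p,1+j]≈0 : ∀ {j} → suc j < p → binomial p (suc j) ≈ 0ℤ
    C[p,1+j]≈0 {j} 1+j<p = *-cancelˡ-≈ (+ suc j) (small-unit (s≤s z≤n) 1+j<p) (begin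
      + suc j * binomial p (suc j)   ≡⟨ C-absorptionℤ q j ⟩
      + p * binomial q j             ≡⟨ ℤP.*-comm (+ p) (binomial q j) ⟩
      binomial q j * + p             ≈⟨ multiple≈0 (binomial q j) ⟩
      0ℤ                             ≡⟨ ℤP.*-zeroʳ (+ suc j) ⟨
      + suc j * 0ℤ                   ∎)
      where open ≈-Reasoning

    frobenius : ∀ (f : ℕ → ℤ) → binomialSum p f ≈ f 0 + f p
    frobenius f = begin
      Σℤ (suc q) g + g p
        ≡⟨ cong (_+ g p) (Σℤ-head q g) ⟩
      g 0 + Σℤ q (g ∘ suc) + g p
        ≈⟨ +-cong (+-cong (≈-refl {g 0}) (Σℤ-cong-≈ q middle≈0)) (≈-refl {g p}) ⟩
      g 0 + Σℤ q (λ _ → 0ℤ) + g p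
        ≡⟨ cong₂ (λ s c → g 0 + s + + c * f p) (Σℤ-zero q (λ _ → refl)) (nCn≡1 p) ⟩
      g 0 + 0ℤ + 1ℤ * f p
        ≡⟨ cong₂ _+_ (ℤP.+-identityʳ (g 0)) (ℤP.*-identityˡ (f p)) ⟩
      1ℤ * f 0 + f p
        ≡⟨ cong (_+ f p) (ℤP.*-identityˡ (f 0)) ⟩
      f 0 + f p ∎
      where
        open ≈-Reasoning
        g : ℕ → ℤ
        g j = binomial p j * f j
        middle≈0 : ∀ {j} → j < q → g (suc j) ≈ 0ℤ
        middle≈0 {j} j<q =
          ≈-trans (*-cong (C[p,1+j]≈0 (s≤s j<q)) (≈-refl {f (suc j)})) (≡⇒≈ (ℤP.*-zeroˡ (f (suc j))))

    [1+√-3]^p≈ : re[1+√-3]^ p ≈ 1ℤ × im[1+√-3]^ p ≈ (- + 3) ^ h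
    [1+√-3]^p≈ =
      ≈-trans (frobenius re[√-3]^) (≡⇒≈ (cong (λ x → 1ℤ + x) (proj₁ ([√-3]^odd h)))) ,
      ≈-trans (frobenius im[√-3]^) (≡⇒≈ (trans (ℤP.+-identityˡ _) (proj₂ ([√-3]^odd h))))

    euler-criterion : (- + 3) ^ h ≈ legendre3 p
    euler-criterion with p % 3 | m≡m%n+[m/n]*n p 3 | m%n<n p 3
    ... | 0 | p≡Q*3 | _ = [ (λ ()) , p≡3⇒ ]′ (prime⇒irreducible isPrime (divides (p ℕ./ 3) p≡Q*3))
      where
        p≡3⇒ : 3 ≡ p → (- + 3) ^ h ≈ 0ℤ
        p≡3⇒ 3≡p = *-cong (neg-cong (subst (λ x → + x ≈ 0ℤ) (sym 3≡p) m≈0)) (≈-refl {(- + 3) ^ n})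
    ... | 1 | p≡1+Q*3 | _ = begin
      (- + 3) ^ h                              ≈⟨ ≈-sym (proj₂ [1+√-3]^p≈) ⟩
      im[1+√-3]^ p                             ≡⟨ cong im[1+√-3]^ p≡Q*3+1 ⟩
      im[1+√-3]^ (Q ℕ.* 3 ℕ.+ 1)               ≡⟨ proj₂ ([1+√-3]^-period Q 1) ⟩
      (- + 8) ^ Q * 1ℤ                         ≡⟨ proj₁ ([1+√-3]^-period Q 1) ⟨
      re[1+√-3]^ (Q ℕ.* 3 ℕ.+ 1)               ≡⟨ cong re[1+√-3]^ p≡Q*3+1 ⟨
      re[1+√-3]^ p                             ≈⟨ proj₁ [1+√-3]^p≈ ⟩
      1ℤ                                       ∎
      where
        open ≈-Reasoning
        Q = p ℕ./ 3
        p≡Q*3+1 : p ≡ Q ℕ.* 3 ℕ.+ 1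
        p≡Q*3+1 = trans p≡1+Q*3 (ℕP.+-comm 1 (Q ℕ.* 3))
    ... | 2 | p≡2+Q*3 | _ = begin
      (- + 3) ^ h                              ≈⟨ ≈-sym (proj₂ [1+√-3]^p≈) ⟩
      im[1+√-3]^ p                             ≡⟨ cong im[1+√-3]^ p≡Q*3+2 ⟩
      im[1+√-3]^ (Q ℕ.* 3 ℕ.+ 2)               ≡⟨ proj₂ ([1+√-3]^-period Q 2) ⟩
      (- + 8) ^ Q * + 2                        ≡⟨ negate ((- + 8) ^ Q) ⟩
      - ((- + 8) ^ Q * - + 2)                  ≡⟨ cong -_ (proj₁ ([1+√-3]^-period Q 2)) ⟨
      - re[1+√-3]^ (Q ℕ.* 3 ℕ.+ 2)             ≡⟨ cong (λ k → - re[1+√-3]^ k) p≡Q*3+2 ⟨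
      - re[1+√-3]^ p                           ≈⟨ neg-cong (proj₁ [1+√-3]^p≈) ⟩
      -1ℤ                                      ∎
      where
        open ≈-Reasoning
        Q = p ℕ./ 3
        p≡Q*3+2 : p ≡ Q ℕ.* 3 ℕ.+ 2
        p≡Q*3+2 = trans p≡2+Q*3 (ℕP.+-comm 2 (Q ℕ.* 3))
        negate : ∀ x → x * + 2 ≡ - (x * - + 2)
        negate = solve-∀
    ... | suc (suc (suc _)) | _ | s≤s (s≤s (s≤s ()))

    -- c_k = C(2k, k)/(k + 1) with C(2k, k) = C(-1/2, k) (-4)^k; modulo p, -1/2 ≡ h and 1/(h + 1) ≡ 2.
    catalanResidue : ℕ → ℤ
    catalanResidue k = + 2 * binomial (suc h) (suc k) * (- + 4) ^ k

    catalanResidue-recurrence : ∀ k →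
      + suc (suc k) * catalanResidue (suc k) ≈ + 2 * (+ 2 * + k + 1ℤ) * catalanResidue k
    catalanResidue-recurrence k = begin
      + suc (suc k) * (+ 2 * b′ * (- + 4 * x))
        ≡⟨ regroup (+ suc (suc k)) b′ (- + 4 * x) ⟩
      + 2 * (+ suc (suc k) * b′) * (- + 4 * x)
        ≡⟨ cong (λ y → + 2 * y * (- + 4 * x)) (C-absorption′ (suc h) (suc k)) ⟩
      + 2 * ((+ suc h - + suc k) * b) * (- + 4 * x)
        ≡⟨ cong₂ (λ s t → + 2 * ((s - t) * b) * (- + 4 * x)) (ℤP.pos-+ 1 h) (ℤP.pos-+ 1 k) ⟩
      + 2 * (((1ℤ + + h) - (1ℤ + + k)) * b) * (- + 4 * x)
        ≡⟨ expand (+ h) (+ k) b x ⟩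
      r + (- + 2 * catalanResidue k) * (1ℤ + (+ h + + h))
        ≈⟨ +-multiple-of-p≈ r (- + 2 * catalanResidue k) ⟩
      r ∎
      where
        open ≈-Reasoning
        b = binomial (suc h) (suc k)
        b′ = binomial (suc h) (suc (suc k))
        x = (- + 4) ^ k
        r = + 2 * (+ 2 * + k + 1ℤ) * catalanResidue k
        regroup : ∀ s b x → s * (+ 2 * b * x) ≡ + 2 * (s * b) * x
        regroup = solve-∀
        expand : ∀ h k b x → + 2 * (((1ℤ + h) - (1ℤ + k)) * b) * (- + 4 * x)
                           ≡ + 2 * (+ 2 * k + 1ℤ) * (+ 2 * b * x) + (- + 2 * (+ 2 * b * x)) * (1ℤ + (h + h))
        expand = solve-∀

    catalan≈catalanResidue : ∀ {k} → suc k < p → catalan k ≈ catalanResidue k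
    catalan≈catalanResidue {zero}  _      = ≈-sym (begin
      + 2 * binomial (suc h) 1 * 1ℤ        ≡⟨ cong (λ c → + 2 * + c * 1ℤ) (nC1≡n (suc h)) ⟩
      + 2 * + suc h * 1ℤ                   ≡⟨ cong (λ c → + 2 * c * 1ℤ) (ℤP.pos-+ 1 h) ⟩
      + 2 * (1ℤ + + h) * 1ℤ                ≡⟨ expand (+ h) ⟩
      1ℤ + 1ℤ * (1ℤ + (+ h + + h))         ≈⟨ +-multiple-of-p≈ 1ℤ 1ℤ ⟩
      1ℤ                                   ∎)
      where
        open ≈-Reasoning
        expand : ∀ h → + 2 * (1ℤ + h) * 1ℤ ≡ 1ℤ + 1ℤ * (1ℤ + (h + h))
        expand = solve-∀
    catalan≈catalanResidue {suc k} 2+k<p = *-cancelˡ-≈ (+ suc (suc k)) (small-unit (s≤s z≤n) 2+k<p) (begin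
      + suc (suc k) * catalan (suc k)
        ≡⟨ catalan-recurrence k ⟩
      + 2 * (+ 2 * + k + 1ℤ) * catalan k
        ≈⟨ *-congˡ (+ 2 * (+ 2 * + k + 1ℤ)) (catalan≈catalanResidue (ℕP.<-trans (ℕP.n<1+n (suc k)) 2+k<p)) ⟩
      + 2 * (+ 2 * + k + 1ℤ) * catalanResidue k
        ≈⟨ catalanResidue-recurrence k ⟨
      + suc (suc k) * catalanResidue (suc k) ∎)
      where open ≈-Reasoning

    catalan[p-1]≈-1 : catalan q ≈ -1ℤ
    catalan[p-1]≈-1 = sub-cong central≈0 C[q+q,p]≈1
      where
        open ≈-Reasoning
        r = n ℕ.+ suc n
        central≈0 : binomial (q ℕ.+ q) q ≈ 0ℤ
        central≈0 = begin
          binomial (q ℕ.+ q) q     ≡⟨ catalan-central q ⟨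
          + p * catalan q          ≡⟨ ℤP.*-comm (+ p) (catalan q) ⟩
          catalan q * + p          ≈⟨ multiple≈0 (catalan q) ⟩
          0ℤ                       ∎
        C[q+q,p]≈1 : binomial (q ℕ.+ q) p ≈ 1ℤ
        C[q+q,p]≈1 = begin
          binomial (q ℕ.+ q) p     ≡⟨ cong (λ t → binomial t p) (cong suc (ℕP.+-suc r r)) ⟩
          binomial (p ℕ.+ r) p     ≡⟨ cong +_ (C-symmetric p r) ⟩
          binomial (p ℕ.+ r) r     ≈⟨ C[p+r,r]≈1 (ℕP.≤-trans (ℕP.n<1+n r) (ℕP.n≤1+n (suc r))) ⟩
          1ℤ                       ∎

    catalan[p+b]≈2catalan[b] : ∀ {b} → suc b < p → catalan (p ℕ.+ b) ≈ + 2 * catalan b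
    catalan[p+b]≈2catalan[b] {zero} _ = begin
      catalan (p ℕ.+ 0)                         ≡⟨ cong catalan (ℕP.+-identityʳ p) ⟩
      catalan p                                 ≡⟨ ℤP.*-identityˡ (catalan p) ⟨
      1ℤ * catalan p                            ≈⟨ *-cong (≈-sym (m+n≈n 1)) (≈-refl {catalan p}) ⟩
      + (p ℕ.+ 1) * catalan p                   ≡⟨ cong (λ t → + t * catalan p) (ℕP.+-comm p 1) ⟩
      + suc p * catalan p                       ≡⟨ catalan-recurrence q ⟩
      + 2 * (+ 2 * + q + 1ℤ) * catalan q        ≈⟨ *-congˡ (+ 2 * (+ 2 * + q + 1ℤ)) catalan[p-1]≈-1 ⟩
      + 2 * (+ 2 * + q + 1ℤ) * -1ℤ              ≡⟨ cong (λ Q → + 2 * (+ 2 * Q + 1ℤ) * -1ℤ) (ℤP.pos-+ h h) ⟩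
      + 2 * (+ 2 * (+ h + + h) + 1ℤ) * -1ℤ      ≡⟨ expand (+ h) ⟩
      + 2 + - + 4 * (1ℤ + (+ h + + h))          ≈⟨ +-multiple-of-p≈ (+ 2) (- + 4) ⟩
      + 2                                       ∎
      where
        open ≈-Reasoning
        expand : ∀ h → + 2 * (+ 2 * (h + h) + 1ℤ) * -1ℤ ≡ + 2 + - + 4 * (1ℤ + (h + h))
        expand = solve-∀
    catalan[p+b]≈2catalan[b] {suc b} 2+b<p =
      *-cancelˡ-≈ (+ suc (suc b)) (small-unit (s≤s z≤n) 2+b<p) (begin
        + suc (suc b) * catalan (p ℕ.+ suc b)
          ≡⟨ cong (λ t → + suc (suc b) * catalan t) (ℕP.+-suc p b) ⟩
        + suc (suc b) * catalan (suc (p ℕ.+ b))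
          ≈⟨ *-cong (≈-sym p+2+b≈2+b) (≈-refl {catalan (suc (p ℕ.+ b))}) ⟩
        + suc (suc (p ℕ.+ b)) * catalan (suc (p ℕ.+ b))
          ≡⟨ catalan-recurrence (p ℕ.+ b) ⟩
        + 2 * (+ 2 * + (p ℕ.+ b) + 1ℤ) * catalan (p ℕ.+ b)
          ≈⟨ *-cong (*-congˡ (+ 2) (+-cong (*-congˡ (+ 2) (m+n≈n b)) (≈-refl {1ℤ}))) (catalan[p+b]≈2catalan[b] 1+b<p) ⟩
        + 2 * (+ 2 * + b + 1ℤ) * (+ 2 * catalan b)
          ≡⟨ swap (+ 2 * (+ 2 * + b + 1ℤ)) (catalan b) ⟩
        + 2 * (+ 2 * (+ 2 * + b + 1ℤ) * catalan b)
          ≡⟨ cong (+ 2 *_) (catalan-recurrence b) ⟨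
        + 2 * (+ suc (suc b) * catalan (suc b))
          ≡⟨ swap (+ suc (suc b)) (catalan (suc b)) ⟨
        + suc (suc b) * (+ 2 * catalan (suc b)) ∎)
      where
        open ≈-Reasoning
        1+b<p : suc b < p
        1+b<p = ℕP.<-trans (ℕP.n<1+n (suc b)) 2+b<p
        p+2+b≈2+b : + suc (suc (p ℕ.+ b)) ≈ + suc (suc b)
        p+2+b≈2+b = subst (λ t → + t ≈ + suc (suc b)) (trans (ℕP.+-suc p (suc b)) (cong suc (ℕP.+-suc p b)))
                          (m+n≈n (suc (suc b)))
        swap : ∀ a x → a * (+ 2 * x) ≡ + 2 * (a * x)
        swap = solve-∀

    weighted-catalan-sum : ∀ (w : ℕ → ℤ) →
      Σℤ p (λ k → w k * catalan k) ≈ + 2 * binomialSum⁺ h (λ k → w k * (- + 4) ^ k) - w q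
    weighted-catalan-sum w = begin
      Σℤ q (λ k → w k * catalan k) + w q * catalan q
        ≈⟨ +-cong (Σℤ-cong-≈ q (λ k<q → *-congˡ (w _) (catalan≈catalanResidue (s≤s k<q))))
                  (*-congˡ (w q) catalan[p-1]≈-1) ⟩
      Σℤ q g + w q * -1ℤ
        ≡⟨ cong (λ t → Σℤ t g + w q * -1ℤ) q≡2+h+n ⟩
      Σℤ (suc h ℕ.+ n) g + w q * -1ℤ
        ≡⟨ cong (_+ w q * -1ℤ) (Σℤ-+ (suc h) n g) ⟩
      Σℤ (suc h) g + Σℤ n (λ k → g (suc h ℕ.+ k)) + w q * -1ℤ
        ≡⟨ cong₂ (λ s t → s + t + w q * -1ℤ) (Σℤ-cong (suc h) (λ {k} _ → regroup k)) (Σℤ-zero n beyond-h) ⟩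
      Σℤ (suc h) (λ k → + 2 * (binomial (suc h) (suc k) * (w k * (- + 4) ^ k))) + 0ℤ + w q * -1ℤ
        ≡⟨ cong (λ s → s + 0ℤ + w q * -1ℤ) (Σℤ-*ˡ (suc h) (+ 2) _) ⟩
      + 2 * S + 0ℤ + w q * -1ℤ
        ≡⟨ tidy (+ 2 * S) (w q) ⟩
      + 2 * S - w q ∎
      where
        open ≈-Reasoning
        g : ℕ → ℤ
        g k = w k * catalanResidue k
        S = binomialSum⁺ h (λ k → w k * (- + 4) ^ k)
        q≡2+h+n : q ≡ suc h ℕ.+ n
        q≡2+h+n = cong suc (ℕP.+-suc n n)
        regroup′ : ∀ w b x → w * (+ 2 * b * x) ≡ + 2 * (b * (w * x))
        regroup′ = solve-∀
        regroup : ∀ k → g k ≡ + 2 * (binomial (suc h) (suc k) * (w k * (- + 4) ^ k))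
        regroup k = regroup′ (w k) (binomial (suc h) (suc k)) ((- + 4) ^ k)
        tidy : ∀ s w → s + 0ℤ + w * -1ℤ ≡ s - w
        tidy = solve-∀
        beyond-h : ∀ k → g (suc h ℕ.+ k) ≡ 0ℤ
        beyond-h k = trans (cong (λ c → w (suc h ℕ.+ k) * (+ 2 * + c * (- + 4) ^ (suc h ℕ.+ k))) (k>n⇒nCk≡0 h+1<h+2+k))
                           (ℤP.*-zeroʳ (w (suc h ℕ.+ k)))
          where h+1<h+2+k = s≤s (ℕP.m≤m+n (suc h) k)

    Y : ℤ
    Y = (- + 3) ^ h

    moment₀ : + 2 * Σℤ p catalan ≈ + 3 * Y - 1ℤ
    moment₀ = begin
      + 2 * Σℤ p catalan
        ≡⟨ cong (+ 2 *_) (Σℤ-cong p (λ {k} _ → sym (ℤP.*-identityˡ (catalan k)))) ⟩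
      + 2 * Σℤ p (λ k → 1ℤ * catalan k)
        ≈⟨ *-congˡ (+ 2) (weighted-catalan-sum (λ _ → 1ℤ)) ⟩
      + 2 * (+ 2 * binomialSum⁺ h (λ k → 1ℤ * x ^ k) - 1ℤ)
        ≡⟨ cong (λ s → + 2 * (+ 2 * s - 1ℤ)) (binomialSum⁺-cong h (λ k → ℤP.*-identityˡ (x ^ k))) ⟩
      + 2 * (+ 2 * S - 1ℤ)
        ≡⟨ rearrange S ⟩
      - (x * S + 1ℤ) - 1ℤ
        ≡⟨ cong (λ t → - t - 1ℤ) (binomialSum⁺-powers h x) ⟩
      - (- + 3 * Y) - 1ℤ
        ≡⟨ simplify Y ⟩
      + 3 * Y - 1ℤ ∎
      where
        open ≈-Reasoning
        x = - + 4
        S = binomialSum⁺ h (x ^_)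
        rearrange : ∀ s → + 2 * (+ 2 * s - 1ℤ) ≡ - (- + 4 * s + 1ℤ) - 1ℤ
        rearrange = solve-∀
        simplify : ∀ y → - (- + 3 * y) - 1ℤ ≡ + 3 * y - 1ℤ
        simplify = solve-∀

    moment₁ : Σℤ p (λ k → + suc k * catalan k) ≈ Y
    moment₁ = begin
      Σℤ p (λ k → + suc k * catalan k)
        ≈⟨ weighted-catalan-sum (λ k → + suc k) ⟩
      + 2 * binomialSum⁺ h (λ k → + suc k * x ^ k) - + p
        ≡⟨ cong (λ s → + 2 * s - + p) (binomialSum⁺-linear h x) ⟩
      + 2 * (+ suc h * Y) - + p
        ≡⟨ cong₂ (λ s t → + 2 * (s * Y) - t) (ℤP.pos-+ 1 h) +p≡1+2h ⟩
      + 2 * ((1ℤ + + h) * Y) - (1ℤ + (+ h + + h))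
        ≡⟨ rearrange (+ h) Y ⟩
      Y + (Y - 1ℤ) * (1ℤ + (+ h + + h))
        ≈⟨ +-multiple-of-p≈ Y (Y - 1ℤ) ⟩
      Y ∎
      where
        open ≈-Reasoning
        x = - + 4
        rearrange : ∀ h y → + 2 * ((1ℤ + h) * y) - (1ℤ + (h + h)) ≡ y + (y - 1ℤ) * (1ℤ + (h + h))
        rearrange = solve-∀

    moment₂ : + 3 * Σℤ p (λ k → + suc k * + suc k * catalan k) ≈ Y
    moment₂ = begin
      + 3 * Σℤ p (λ k → + suc k * + suc k * catalan k)
        ≈⟨ *-congˡ (+ 3) (weighted-catalan-sum (λ k → + suc k * + suc k)) ⟩
      + 3 * (+ 2 * binomialSum⁺ h (λ k → + suc k * + suc k * x ^ k) - + p * + p)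
        ≡⟨ cong (λ s → + 3 * (+ 2 * s - + p * + p)) (binomialSum⁺-quadratic n x) ⟩
      + 3 * (+ 2 * (+ suc h * (- + 3 * Z + + h * x * Z)) - + p * + p)
        ≡⟨ cong₂ (λ s t → + 3 * (+ 2 * (s * (- + 3 * Z + + h * x * Z)) - t * t)) (ℤP.pos-+ 1 h) +p≡1+2h ⟩
      + 3 * (+ 2 * ((1ℤ + + h) * (- + 3 * Z + + h * - + 4 * Z)) - (1ℤ + (+ h + + h)) * (1ℤ + (+ h + + h)))
        ≡⟨ rearrange (+ h) Z ⟩
      - + 3 * Z + (- + 3 * Z * (+ 5 + + 4 * + h) - + 3 * (1ℤ + (+ h + + h))) * (1ℤ + (+ h + + h))
        ≈⟨ +-multiple-of-p≈ (- + 3 * Z) (- + 3 * Z * (+ 5 + + 4 * + h) - + 3 * (1ℤ + (+ h + + h))) ⟩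
      Y ∎
      where
        open ≈-Reasoning
        x = - + 4
        Z = (- + 3) ^ n
        rearrange : ∀ h z → + 3 * (+ 2 * ((1ℤ + h) * (- + 3 * z + h * - + 4 * z)) - (1ℤ + (h + h)) * (1ℤ + (h + h)))
                          ≡ - + 3 * z + (- + 3 * z * (+ 5 + + 4 * h) - + 3 * (1ℤ + (h + h))) * (1ℤ + (h + h))
        rearrange = solve-∀

    Σℤ-translate-by-p : ∀ {d} → d < p → (f : ℕ → ℤ) → (∀ {b} → suc b < p → f (p ℕ.+ b) ≈ + 2 * f b) →
                        Σℤ p (λ k → f (k ℕ.+ d)) ≈ Σℤ p f + Σℤ d f
    Σℤ-translate-by-p {d} d<p f doubles =
      ≈-trans (Σℤ-translate-≈ p d (+ 2) f (λ b<d → doubles (ℕP.≤-trans (s≤s b<d) d<p)))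
              (≡⇒≈ (cong (λ t → Σℤ p f + t) (ℤP.*-identityˡ (Σℤ d f))))

    weighted-catalan-doubles : (w : ℕ → ℤ) → (∀ b → w (p ℕ.+ b) ≈ w b) →
                               ∀ {b} → suc b < p → w (p ℕ.+ b) * catalan (p ℕ.+ b) ≈ + 2 * (w b * catalan b)
    weighted-catalan-doubles w periodic {b} 1+b<p =
      ≈-trans (*-cong (periodic b) (catalan[p+b]≈2catalan[b] 1+b<p)) (≡⇒≈ (swap (w b) (catalan b)))
      where swap : ∀ w c → w * (+ 2 * c) ≡ + 2 * (w * c)
            swap = solve-∀

    module _ {d : ℕ} (d<p : d < p) where

      shifted-moment₀ : + 2 * Σℤ p (λ k → catalan (k ℕ.+ d)) ≈ + 3 * Y - 1ℤ + + 2 * Σℤ d catalan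
      shifted-moment₀ = begin
        + 2 * Σℤ p (λ k → catalan (k ℕ.+ d))
          ≈⟨ *-congˡ (+ 2) (Σℤ-translate-by-p d<p catalan catalan[p+b]≈2catalan[b]) ⟩
        + 2 * (Σℤ p catalan + Σℤ d catalan)
          ≡⟨ ℤP.*-distribˡ-+ (+ 2) (Σℤ p catalan) (Σℤ d catalan) ⟩
        + 2 * Σℤ p catalan + + 2 * Σℤ d catalan
          ≈⟨ +-cong moment₀ (≈-refl {+ 2 * Σℤ d catalan}) ⟩
        + 3 * Y - 1ℤ + + 2 * Σℤ d catalan ∎
        where open ≈-Reasoning

      shifted-moment₁ : + 2 * Σℤ p (λ k → + k * catalan (k ℕ.+ d))
             ≈ + (d ℕ.+ 1) * (1ℤ - Y) - + 2 * (Y * + d) - + 2 * Σℤ (suc d) (λ k → + k * catalan (d ℕ.∸ k))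
      shifted-moment₁ = begin
        + 2 * Σℤ p (λ k → + k * catalan (k ℕ.+ d))
          ≡⟨ cong (+ 2 *_) (Σℤ-cong p (λ {k} _ → cong (_* catalan (k ℕ.+ d)) (sym (k+d-d≡k k)))) ⟩
        + 2 * Σℤ p (λ k → f (k ℕ.+ d))
          ≈⟨ *-congˡ (+ 2) (Σℤ-translate-by-p d<p f (weighted-catalan-doubles w periodic)) ⟩
        + 2 * (Σℤ p f + A)
          ≡⟨ cong (λ s → + 2 * (s + A)) expand ⟩
        + 2 * (1ℤ * P₁ + - E * P₀ + A)
          ≡⟨ regroup P₀ P₁ A E ⟩
        + 2 * P₁ + - E * (+ 2 * P₀) + + 2 * A
          ≈⟨ +-cong (+-cong (*-congˡ (+ 2) moment₁) (*-congˡ (- E) moment₀)) (≈-refl {+ 2 * A}) ⟩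
        + 2 * Y + - E * (+ 3 * Y - 1ℤ) + + 2 * A
          ≡⟨ cong (λ e → + 2 * Y + - e * (+ 3 * Y - 1ℤ) + + 2 * A) (ℤP.pos-+ 1 d) ⟩
        + 2 * Y + - (1ℤ + + d) * (+ 3 * Y - 1ℤ) + + 2 * A
          ≡⟨ simplify Y (+ d) A ⟩
        (+ d + 1ℤ) * (1ℤ - Y) - + 2 * (Y * + d) - + 2 * - A
          ≡⟨ cong₂ (λ e t → e * (1ℤ - Y) - + 2 * (Y * + d) - + 2 * t) (ℤP.pos-+ d 1) (Σℤ-reverse-linear d catalan) ⟨
        + (d ℕ.+ 1) * (1ℤ - Y) - + 2 * (Y * + d) - + 2 * Σℤ (suc d) (λ k → + k * catalan (d ℕ.∸ k)) ∎
        where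
          open ≈-Reasoning
          E = + suc d
          w : ℕ → ℤ
          w m = + m - + d
          f : ℕ → ℤ
          f m = w m * catalan m
          A = Σℤ d f
          P₀ = Σℤ p catalan
          P₁ = Σℤ p (λ m → + suc m * catalan m)
          periodic : ∀ b → w (p ℕ.+ b) ≈ w b
          periodic b = sub-cong (m+n≈n b) (≈-refl {+ d})
          cancel : ∀ k d → k + d - d ≡ k
          cancel = solve-∀
          k+d-d≡k : ∀ k → + (k ℕ.+ d) - + d ≡ + k
          k+d-d≡k k = trans (cong (_- + d) (ℤP.pos-+ k d)) (cancel (+ k) (+ d))
          centre′ : ∀ m d c → (m - d) * c ≡ 1ℤ * ((1ℤ + m) * c) + - (1ℤ + d) * c
          centre′ = solve-∀
          centre : ∀ m → f m ≡ 1ℤ * (+ suc m * catalan m) + - E * catalan m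
          centre m = trans (centre′ (+ m) (+ d) (catalan m))
                           (sym (cong₂ (λ s e → 1ℤ * (s * catalan m) + - e * catalan m) (ℤP.pos-+ 1 m) (ℤP.pos-+ 1 d)))
          expand : Σℤ p f ≡ 1ℤ * P₁ + - E * P₀
          expand = trans (Σℤ-cong p (λ {m} _ → centre m)) (Σℤ-linear p 1ℤ (- E) (λ m → + suc m * catalan m) catalan)
          regroup : ∀ p₀ p₁ a e → + 2 * (1ℤ * p₁ + - e * p₀ + a) ≡ + 2 * p₁ + - e * (+ 2 * p₀) + + 2 * a
          regroup = solve-∀
          simplify : ∀ y d a → + 2 * y + - (1ℤ + d) * (+ 3 * y - 1ℤ) + + 2 * a
                               ≡ (d + 1ℤ) * (1ℤ - y) - + 2 * (y * d) - + 2 * - a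
          simplify = solve-∀

      shifted-moment₂ : + 6 * Σℤ p (λ k → + (k ℕ.* k) * catalan (k ℕ.+ d))
             ≈ (+ (9 ℕ.* d ℕ.* d ℕ.+ 6 ℕ.* d) - 1ℤ) * Y - + 3 * + ((d ℕ.+ 1) ℕ.* (d ℕ.+ 1))
               + + 6 * Σℤ d (λ j → + (suc j ℕ.* suc j) * catalan (d ℕ.∸ suc j))
      shifted-moment₂ = begin
        + 6 * Σℤ p (λ k → + (k ℕ.* k) * catalan (k ℕ.+ d))
          ≡⟨ cong (+ 6 *_) (Σℤ-cong p (λ {k} _ → cong (_* catalan (k ℕ.+ d)) (sym (w[k+d]≡k² k)))) ⟩
        + 6 * Σℤ p (λ k → f (k ℕ.+ d))
          ≈⟨ *-congˡ (+ 6) (Σℤ-translate-by-p d<p f (weighted-catalan-doubles w periodic)) ⟩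
        + 6 * (Σℤ p f + A)
          ≡⟨ cong (λ s → + 6 * (s + A)) expand ⟩
        + 6 * (1ℤ * P₂ + - (+ 2 * E) * P₁ + E * E * P₀ + A)
          ≡⟨ regroup P₀ P₁ P₂ A E ⟩
        + 2 * (+ 3 * P₂) + - (+ 12 * E) * P₁ + + 3 * (E * E) * (+ 2 * P₀) + + 6 * A
          ≈⟨ +-cong (+-cong (+-cong (*-congˡ (+ 2) moment₂) (*-congˡ (- (+ 12 * E)) moment₁))
                            (*-congˡ (+ 3 * (E * E)) moment₀)) (≈-refl {+ 6 * A}) ⟩
        + 2 * Y + - (+ 12 * E) * Y + + 3 * (E * E) * (+ 3 * Y - 1ℤ) + + 6 * A
          ≡⟨ cong (λ e → + 2 * Y + - (+ 12 * e) * Y + + 3 * (e * e) * (+ 3 * Y - 1ℤ) + + 6 * A) (ℤP.pos-+ 1 d) ⟩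
        + 2 * Y + - (+ 12 * (1ℤ + + d)) * Y + + 3 * ((1ℤ + + d) * (1ℤ + + d)) * (+ 3 * Y - 1ℤ) + + 6 * A
          ≡⟨ simplify Y (+ d) A ⟩
        (+ 9 * + d * + d + + 6 * + d - 1ℤ) * Y - + 3 * ((+ d + 1ℤ) * (+ d + 1ℤ)) + + 6 * A
          ≡⟨ cong₂ (λ g e → (g - 1ℤ) * Y - + 3 * e + + 6 * A) 9d²+6d [d+1]² ⟨
        (+ (9 ℕ.* d ℕ.* d ℕ.+ 6 ℕ.* d) - 1ℤ) * Y - + 3 * + ((d ℕ.+ 1) ℕ.* (d ℕ.+ 1)) + + 6 * A
          ≡⟨ cong (λ a → (+ (9 ℕ.* d ℕ.* d ℕ.+ 6 ℕ.* d) - 1ℤ) * Y - + 3 * + ((d ℕ.+ 1) ℕ.* (d ℕ.+ 1)) + + 6 * a)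
                  (Σℤ-reverse-quadratic d catalan) ⟨
        (+ (9 ℕ.* d ℕ.* d ℕ.+ 6 ℕ.* d) - 1ℤ) * Y - + 3 * + ((d ℕ.+ 1) ℕ.* (d ℕ.+ 1))
          + + 6 * Σℤ d (λ j → + (suc j ℕ.* suc j) * catalan (d ℕ.∸ suc j)) ∎
        where
          open ≈-Reasoning
          E = + suc d
          w : ℕ → ℤ
          w m = (+ m - + d) * (+ m - + d)
          f : ℕ → ℤ
          f m = w m * catalan m
          A = Σℤ d f
          P₀ = Σℤ p catalan
          P₁ = Σℤ p (λ m → + suc m * catalan m)
          P₂ = Σℤ p (λ m → + suc m * + suc m * catalan m)
          periodic : ∀ b → w (p ℕ.+ b) ≈ w b
          periodic b = *-cong (sub-cong (m+n≈n b) (≈-refl {+ d})) (sub-cong (m+n≈n b) (≈-refl {+ d}))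
          cancel : ∀ k d → (k + d - d) * (k + d - d) ≡ k * k
          cancel = solve-∀
          w[k+d]≡k² : ∀ k → w (k ℕ.+ d) ≡ + (k ℕ.* k)
          w[k+d]≡k² k = trans (cong (λ x → (x - + d) * (x - + d)) (ℤP.pos-+ k d))
                              (trans (cancel (+ k) (+ d)) (sym (ℤP.pos-* k k)))
          centre′ : ∀ m d c → (m - d) * (m - d) * c
                              ≡ 1ℤ * ((1ℤ + m) * (1ℤ + m) * c) + - (+ 2 * (1ℤ + d)) * ((1ℤ + m) * c)
                                + (1ℤ + d) * (1ℤ + d) * c
          centre′ = solve-∀
          centre : ∀ m → f m ≡ 1ℤ * (+ suc m * + suc m * catalan m) + - (+ 2 * E) * (+ suc m * catalan m)
                               + E * E * catalan m
          centre m = trans (centre′ (+ m) (+ d) (catalan m))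
                           (sym (cong₂ (λ s e → 1ℤ * (s * s * catalan m) + - (+ 2 * e) * (s * catalan m) + e * e * catalan m)
                                       (ℤP.pos-+ 1 m) (ℤP.pos-+ 1 d)))
          expand : Σℤ p f ≡ 1ℤ * P₂ + - (+ 2 * E) * P₁ + E * E * P₀
          expand = trans (Σℤ-cong p (λ {m} _ → centre m))
                         (Σℤ-linear₃ p 1ℤ (- (+ 2 * E)) (E * E) (λ m → + suc m * + suc m * catalan m)
                                     (λ m → + suc m * catalan m) catalan)
          regroup : ∀ p₀ p₁ p₂ a e → + 6 * (1ℤ * p₂ + - (+ 2 * e) * p₁ + e * e * p₀ + a)
                                     ≡ + 2 * (+ 3 * p₂) + - (+ 12 * e) * p₁ + + 3 * (e * e) * (+ 2 * p₀) + + 6 * a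
          regroup = solve-∀
          simplify : ∀ y d a → + 2 * y + - (+ 12 * (1ℤ + d)) * y + + 3 * ((1ℤ + d) * (1ℤ + d)) * (+ 3 * y - 1ℤ)
                                 + + 6 * a
                               ≡ (+ 9 * d * d + + 6 * d - 1ℤ) * y - + 3 * ((d + 1ℤ) * (d + 1ℤ)) + + 6 * a
          simplify = solve-∀
          9d²+6d : + (9 ℕ.* d ℕ.* d ℕ.+ 6 ℕ.* d) ≡ + 9 * + d * + d + + 6 * + d
          9d²+6d = trans (ℤP.pos-+ (9 ℕ.* d ℕ.* d) (6 ℕ.* d))
                         (cong₂ _+_ (trans (ℤP.pos-* (9 ℕ.* d) d) (cong (_* + d) (ℤP.pos-* 9 d))) (ℤP.pos-* 6 d))
          [d+1]² : + ((d ℕ.+ 1) ℕ.* (d ℕ.+ 1)) ≡ (+ d + 1ℤ) * (+ d + 1ℤ)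
          [d+1]² = trans (ℤP.pos-* (d ℕ.+ 1) (d ℕ.+ 1)) (cong₂ _*_ (ℤP.pos-+ d 1) (ℤP.pos-+ d 1))

-- Transfer to ℚ

open import Defs
open import Data.Integer as ℤ using (ℤ; +_)
import Data.Integer.Properties as ℤP
import Data.Integer.Divisibility as ℤD
open import Data.Rational as ℚ using (ℚ; _/_; _+_; _*_; _-_; -_; 0ℚ; 1ℚ)
import Data.Rational.Properties as ℚP
open import Data.Rational.Unnormalised as ℚᵘ using (mkℚᵘ; *≡*)
import Data.Rational.Unnormalised.Properties as ℚᵘP
open import Data.Rational.Solver using (module +-*-Solver)

toℚ : ℤ → ℚ
toℚ z = z / 1

toℚᵘ-/ : ∀ z n → ℚ.toℚᵘ (z / suc n) ℚᵘ.≃ mkℚᵘ z n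
toℚᵘ-/ z n = ℚP.toℚᵘ-fromℚᵘ (mkℚᵘ z n)

toℚ-homo-+ : ∀ a b → toℚ (a ℤ.+ b) ≡ toℚ a + toℚ b
toℚ-homo-+ a b = ℚP.toℚᵘ-injective (begin
  ℚ.toℚᵘ (toℚ (a ℤ.+ b))               ≈⟨ toℚᵘ-/ (a ℤ.+ b) 0 ⟩
  mkℚᵘ (a ℤ.+ b) 0                     ≈⟨ *≡* (denominators a b) ⟨
  mkℚᵘ a 0 ℚᵘ.+ mkℚᵘ b 0               ≈⟨ ℚᵘP.+-cong (toℚᵘ-/ a 0) (toℚᵘ-/ b 0) ⟨
  ℚ.toℚᵘ (toℚ a) ℚᵘ.+ ℚ.toℚᵘ (toℚ b)   ≈⟨ ℚP.toℚᵘ-homo-+ (toℚ a) (toℚ b) ⟨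
  ℚ.toℚᵘ (toℚ a + toℚ b)               ∎)
  where
    open ℚᵘP.≃-Reasoning
    denominators : ∀ a b → (a ℤ.* + 1 ℤ.+ b ℤ.* + 1) ℤ.* + 1 ≡ (a ℤ.+ b) ℤ.* + 1
    denominators = solve-∀

toℚ-homo-* : ∀ a b → toℚ (a ℤ.* b) ≡ toℚ a * toℚ b
toℚ-homo-* a b = ℚP.toℚᵘ-injective (begin
  ℚ.toℚᵘ (toℚ (a ℤ.* b))               ≈⟨ toℚᵘ-/ (a ℤ.* b) 0 ⟩
  mkℚᵘ a 0 ℚᵘ.* mkℚᵘ b 0               ≈⟨ ℚᵘP.*-cong (toℚᵘ-/ a 0) (toℚᵘ-/ b 0) ⟨
  ℚ.toℚᵘ (toℚ a) ℚᵘ.* ℚ.toℚᵘ (toℚ b)   ≈⟨ ℚP.toℚᵘ-homo-* (toℚ a) (toℚ b) ⟨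
  ℚ.toℚᵘ (toℚ a * toℚ b)               ∎)
  where open ℚᵘP.≃-Reasoning

toℚ-homo‿- : ∀ a → toℚ (ℤ.- a) ≡ - toℚ a
toℚ-homo‿- a = ℚP.toℚᵘ-injective (begin
  ℚ.toℚᵘ (toℚ (ℤ.- a))                 ≈⟨ toℚᵘ-/ (ℤ.- a) 0 ⟩
  ℚᵘ.- mkℚᵘ a 0                        ≈⟨ ℚᵘP.-‿cong (toℚᵘ-/ a 0) ⟨
  ℚᵘ.- ℚ.toℚᵘ (toℚ a)                  ≈⟨ ℚP.toℚᵘ-homo‿- (toℚ a) ⟨
  ℚ.toℚᵘ (- toℚ a)                     ∎)
  where open ℚᵘP.≃-Reasoning

toℚ-homo-sub : ∀ a b → toℚ (a ℤ.- b) ≡ toℚ a - toℚ b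
toℚ-homo-sub a b = trans (toℚ-homo-+ a (ℤ.- b)) (cong (λ x → toℚ a + x) (toℚ-homo‿- b))

/-as-* : ∀ z n → z / suc n ≡ toℚ z * (+ 1 / suc n)
/-as-* z n = ℚP.toℚᵘ-injective (begin
  ℚ.toℚᵘ (z / suc n)                           ≈⟨ toℚᵘ-/ z n ⟩
  mkℚᵘ z n                                     ≈⟨ *≡* (regroup z (+ suc n)) ⟨
  mkℚᵘ z 0 ℚᵘ.* mkℚᵘ (+ 1) n                   ≈⟨ ℚᵘP.*-cong (toℚᵘ-/ z 0) (toℚᵘ-/ (+ 1) n) ⟨
  ℚ.toℚᵘ (toℚ z) ℚᵘ.* ℚ.toℚᵘ (+ 1 / suc n)     ≈⟨ ℚP.toℚᵘ-homo-* (toℚ z) (+ 1 / suc n) ⟨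
  ℚ.toℚᵘ (toℚ z * (+ 1 / suc n))               ∎)
  where
    open ℚᵘP.≃-Reasoning
    regroup : ∀ z m → (z ℤ.* + 1) ℤ.* m ≡ z ℤ.* (+ 1 ℤ.* m)
    regroup = solve-∀

toℚ-n*1/n≡1 : ∀ n → toℚ (+ suc n) * (+ 1 / suc n) ≡ 1ℚ
toℚ-n*1/n≡1 n = trans (sym (/-as-* (+ suc n) n))
                      (ℚP.fromℚᵘ-cong {mkℚᵘ (+ suc n) n} {mkℚᵘ (+ 1) 0} (*≡* (ℤP.*-comm (+ suc n) (+ 1))))

Cat≡toℚ-catalan : ∀ n → Cat n ≡ toℚ (catalan n)
Cat≡toℚ-catalan n = ℚP.fromℚᵘ-cong {mkℚᵘ (binomial (n ℕ.+ n) n) n} {mkℚᵘ (catalan n) 0} (*≡* (begin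
  binomial (n ℕ.+ n) n ℤ.* + 1   ≡⟨ ℤP.*-identityʳ _ ⟩
  binomial (n ℕ.+ n) n           ≡⟨ catalan-central n ⟨
  + suc n ℤ.* catalan n          ≡⟨ ℤP.*-comm (+ suc n) (catalan n) ⟩
  catalan n ℤ.* + suc n          ∎))
  where open ≡-Reasoning

Σ<-toℚ : ∀ n {f : ℕ → ℚ} {g : ℕ → ℤ} → (∀ k → f k ≡ toℚ (g k)) → Σ< n f ≡ toℚ (Σℤ n g)
Σ<-toℚ zero    f≡g = refl
Σ<-toℚ (suc n) {g = g} f≡g = trans (cong₂ _+_ (Σ<-toℚ n f≡g) (f≡g n)) (sym (toℚ-homo-+ (Σℤ n g) (g n)))

Σ<-Cat : ∀ n (f : ℕ → ℕ) → Σ< n (λ k → Cat (f k)) ≡ toℚ (Σℤ n (λ k → catalan (f k)))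
Σ<-Cat n f = Σ<-toℚ n (λ k → Cat≡toℚ-catalan (f k))

Σ<-ι*Cat : ∀ n (w f : ℕ → ℕ) → Σ< n (λ k → ι (w k) * Cat (f k)) ≡ toℚ (Σℤ n (λ k → + w k ℤ.* catalan (f k)))
Σ<-ι*Cat n w f = Σ<-toℚ n (λ k → trans (cong (ι (w k) *_) (Cat≡toℚ-catalan (f k))) (sym (toℚ-homo-* (+ w k) (catalan (f k)))))

leg3≡toℚ-legendre3 : ∀ a → leg3 a ≡ toℚ (legendre3 a)
leg3≡toℚ-legendre3 a with a % 3
... | 0           = refl
... | 1           = refl
... | suc (suc _) = refl

isThree≡0 : ∀ {m} → m ≢ 3 → isThree m ≡ 0ℚ
isThree≡0 {m} m≢3 with m ℕ.≡ᵇ 3 in m≡ᵇ3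
... | false = refl
... | true  = ⊥-elim (m≢3 (ℕP.≡ᵇ⇒≡ m 3 (subst T (sym m≡ᵇ3) tt)))

≈⇒≡[modℚ] : ∀ {p v} .{{_ : ℕ.NonZero v}} → ¬ p ∣ v → ∀ {X R} →
            Modulo._≈_ p (+ v ℤ.* X) R → toℚ X ≡ toℚ R * (+ 1 / v) [modℚ p ]
≈⇒≡[modℚ] {p} {suc w} p∤v {X} {R} vX≈R = u , suc w , _ , p∤v , Modulo.≈⇒∣ p vX≈R , (begin
  toℚ X - toℚ R * t
    ≡⟨ cong (λ x → x - toℚ R * t) (ℚP.*-identityˡ (toℚ X)) ⟨
  1ℚ * toℚ X - toℚ R * t
    ≡⟨ cong (λ o → o * toℚ X - toℚ R * t) (toℚ-n*1/n≡1 w) ⟨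
  (V * t) * toℚ X - toℚ R * t
    ≡⟨ factor V t (toℚ X) (toℚ R) ⟩
  (V * toℚ X - toℚ R) * t
    ≡⟨ cong (_* t) (trans (toℚ-homo-sub (+ suc w ℤ.* X) R) (cong (_- toℚ R) (toℚ-homo-* (+ suc w) X))) ⟨
  toℚ u * t
    ≡⟨ /-as-* u w ⟨
  u / suc w ∎)
  where
    open ≡-Reasoning
    open +-*-Solver
    u = + suc w ℤ.* X ℤ.- R
    V = toℚ (+ suc w)
    t = + 1 / suc w
    factor : ∀ V t x r → (V * t) * x - r * t ≡ (V * x - r) * t
    factor = solve 4 (λ V t x r → (V :* t) :* x :- r :* t := (V :* x :- r) :* t) refl

-- Stated for the difference δ = a - b, which Agda can read off an unfolded `a ≡ b [modℚ p ]`.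
≡[modℚ]-by-computation : ∀ {p} {δ : ℚ} {p∣u : True (p ∣? ℤ.∣ ℚ.↥ δ ∣)} {p∤v : False (p ∣? ℚ.↧ₙ δ)} →
  Σ ℤ λ u → Σ ℕ λ v → Σ (ℕ.NonZero v) λ nz → (¬ (p ∣ v)) × (+ p ℤD.∣ u) × (δ ≡ _/_ u v {{nz}})
≡[modℚ]-by-computation {δ = δ} {p∣u} {p∤v} = ℚ.↥ δ , ℚ.↧ₙ δ , _ , toWitnessFalse p∤v , toWitness p∣u , sym (ℚP.↥p/↧p≡p δ)

-- The three congruences of the theorem, named so that the case split on p can take them as an
-- explicit motive: a `with` on p in the theorem itself makes Agda normalise these types.
Congruence₁ Congruence₂ Congruence₃ : ℕ → ℕ → Set
Congruence₁ p d =
  Σ< p (λ k → Cat (k ℕ.+ d)) ≡ (ι 3 * leg3 p - ι 1) * (+ 1 / 2) + Σ< d (λ k → Cat k) [modℚ p ]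
Congruence₂ p d =
  Σ< p (λ k → ι k * Cat (k ℕ.+ d))
    ≡ (ι (d ℕ.+ 1) * (+ 1 / 2)) * (ι 1 - leg3 p) - leg3 p * ι d - Σ< (suc d) (λ k → ι k * Cat (d ℕ.∸ k)) [modℚ p ]
Congruence₃ p d =
  Σ< p (λ k → ι (k ℕ.* k) * Cat (k ℕ.+ d))
    ≡ ((ι (9 ℕ.* d ℕ.* d ℕ.+ 6 ℕ.* d) - ι 1) * (+ 1 / 6)) * leg3 p - ι ((d ℕ.+ 1) ℕ.* (d ℕ.+ 1)) * (+ 1 / 2) - isThree p
      + Σ< d (λ j → ι (suc j ℕ.* suc j) * Cat (d ℕ.∸ suc j)) [modℚ p ]

Congruences : ℕ → ℕ → Set
Congruences p d = Congruence₁ p d × Congruence₂ p d × Congruence₃ p d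

module PrimeAtLeast5 (n : ℕ) (isPrime : Prime (suc (suc (suc n) ℕ.+ suc (suc n)))) {d : ℕ}
                 (d<p : d < suc (suc (suc n) ℕ.+ suc (suc n))) where

  open OddPrime (suc n) isPrime

  L : ℤ
  L = legendre3 p

  3<p : 3 < p
  3<p = s≤s (s≤s (s≤s (ℕP.≤-trans (s≤s z≤n) (ℕP.m≤n+m (suc (suc n)) n))))

  p∤2 : ¬ p ∣ 2
  p∤2 = small-unit (s≤s z≤n) (ℕP.<-trans (ℕP.n<1+n 2) 3<p)

  p∤6 : ¬ p ∣ 6
  p∤6 = unit-* {+ 2} {+ 3} p∤2 (small-unit (s≤s z≤n) 3<p)

  congruence₁ : Congruence₁ p d
  congruence₁ = subst₂ (λ a b → a ≡ b [modℚ p ]) (sym (Σ<-Cat p (λ k → k ℕ.+ d))) rhs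
                       (≈⇒≡[modℚ] p∤2 inℤ)
    where
      open +-*-Solver
      A = Σℤ d catalan
      inℤ : + 2 ℤ.* Σℤ p (λ k → catalan (k ℕ.+ d)) ≈ + 3 ℤ.* L ℤ.- ℤ.1ℤ ℤ.+ + 2 ℤ.* A
      inℤ = ≈-trans (shifted-moment₀ d<p) (+-cong (sub-cong (*-congˡ (+ 3) euler-criterion) ≈-refl) ≈-refl)
      rearrange : ∀ l a → (ι 3 * l - ι 1 + ι 2 * a) * (+ 1 / 2) ≡ (ι 3 * l - ι 1) * (+ 1 / 2) + a
      rearrange = solve 2 (λ l a → (con (ι 3) :* l :- con (ι 1) :+ con (ι 2) :* a) :* con (+ 1 / 2)
                                 := (con (ι 3) :* l :- con (ι 1)) :* con (+ 1 / 2) :+ a) refl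
      push : toℚ (+ 3 ℤ.* L ℤ.- ℤ.1ℤ ℤ.+ + 2 ℤ.* A) ≡ ι 3 * toℚ L - ι 1 + ι 2 * toℚ A
      push = trans (toℚ-homo-+ (+ 3 ℤ.* L ℤ.- ℤ.1ℤ) (+ 2 ℤ.* A))
                   (cong₂ _+_ (trans (toℚ-homo-sub (+ 3 ℤ.* L) ℤ.1ℤ) (cong (_- ι 1) (toℚ-homo-* (+ 3) L))) (toℚ-homo-* (+ 2) A))
      rhs : toℚ (+ 3 ℤ.* L ℤ.- ℤ.1ℤ ℤ.+ + 2 ℤ.* A) * (+ 1 / 2) ≡ (ι 3 * leg3 p - ι 1) * (+ 1 / 2) + Σ< d (λ k → Cat k)
      rhs = begin
        toℚ (+ 3 ℤ.* L ℤ.- ℤ.1ℤ ℤ.+ + 2 ℤ.* A) * (+ 1 / 2)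
          ≡⟨ cong (_* (+ 1 / 2)) push ⟩
        (ι 3 * toℚ L - ι 1 + ι 2 * toℚ A) * (+ 1 / 2)
          ≡⟨ rearrange (toℚ L) (toℚ A) ⟩
        (ι 3 * toℚ L - ι 1) * (+ 1 / 2) + toℚ A
          ≡⟨ cong₂ (λ l a → (ι 3 * l - ι 1) * (+ 1 / 2) + a) (leg3≡toℚ-legendre3 p) (Σ<-Cat d (λ k → k)) ⟨
        (ι 3 * leg3 p - ι 1) * (+ 1 / 2) + Σ< d (λ k → Cat k) ∎
        where open ≡-Reasoning

  congruence₂ : Congruence₂ p d
  congruence₂ = subst₂ (λ a b → a ≡ b [modℚ p ]) (sym (Σ<-ι*Cat p (λ k → k) (λ k → k ℕ.+ d))) rhs
                       (≈⇒≡[modℚ] p∤2 inℤ)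
    where
      open +-*-Solver
      E = + (d ℕ.+ 1)
      Q = Σℤ (suc d) (λ k → + k ℤ.* catalan (d ℕ.∸ k))
      inℤ : + 2 ℤ.* Σℤ p (λ k → + k ℤ.* catalan (k ℕ.+ d)) ≈ E ℤ.* (ℤ.1ℤ ℤ.- L) ℤ.- + 2 ℤ.* (L ℤ.* + d) ℤ.- + 2 ℤ.* Q
      inℤ = ≈-trans (shifted-moment₁ d<p) (sub-cong (sub-cong (*-congˡ E (sub-cong (≈-refl {ℤ.1ℤ}) euler-criterion))
                                                          (*-congˡ (+ 2) (*-cong euler-criterion (≈-refl {+ d}))))
                                                (≈-refl {+ 2 ℤ.* Q}))
      push : toℚ (E ℤ.* (ℤ.1ℤ ℤ.- L) ℤ.- + 2 ℤ.* (L ℤ.* + d) ℤ.- + 2 ℤ.* Q)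
             ≡ ι (d ℕ.+ 1) * (ι 1 - toℚ L) - ι 2 * (toℚ L * ι d) - ι 2 * toℚ Q
      push = trans (toℚ-homo-sub (E ℤ.* (ℤ.1ℤ ℤ.- L) ℤ.- + 2 ℤ.* (L ℤ.* + d)) (+ 2 ℤ.* Q))
               (cong₂ _-_ (trans (toℚ-homo-sub (E ℤ.* (ℤ.1ℤ ℤ.- L)) (+ 2 ℤ.* (L ℤ.* + d)))
                                 (cong₂ _-_ (trans (toℚ-homo-* E (ℤ.1ℤ ℤ.- L)) (cong (ι (d ℕ.+ 1) *_) (toℚ-homo-sub ℤ.1ℤ L)))
                                            (trans (toℚ-homo-* (+ 2) (L ℤ.* + d)) (cong (ι 2 *_) (toℚ-homo-* L (+ d))))))
                          (toℚ-homo-* (+ 2) Q))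
      rearrange : ∀ e l δ s → (e * (ι 1 - l) - ι 2 * (l * δ) - ι 2 * s) * (+ 1 / 2) ≡ (e * (+ 1 / 2)) * (ι 1 - l) - l * δ - s
      rearrange = solve 4 (λ e l δ s → (e :* (con (ι 1) :- l) :- con (ι 2) :* (l :* δ) :- con (ι 2) :* s) :* con (+ 1 / 2)
                                      := (e :* con (+ 1 / 2)) :* (con (ι 1) :- l) :- l :* δ :- s) refl
      rhs : toℚ (E ℤ.* (ℤ.1ℤ ℤ.- L) ℤ.- + 2 ℤ.* (L ℤ.* + d) ℤ.- + 2 ℤ.* Q) * (+ 1 / 2)
            ≡ (ι (d ℕ.+ 1) * (+ 1 / 2)) * (ι 1 - leg3 p) - leg3 p * ι d - Σ< (suc d) (λ k → ι k * Cat (d ℕ.∸ k))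
      rhs = begin
        toℚ (E ℤ.* (ℤ.1ℤ ℤ.- L) ℤ.- + 2 ℤ.* (L ℤ.* + d) ℤ.- + 2 ℤ.* Q) * (+ 1 / 2)
          ≡⟨ cong (_* (+ 1 / 2)) push ⟩
        (ι (d ℕ.+ 1) * (ι 1 - toℚ L) - ι 2 * (toℚ L * ι d) - ι 2 * toℚ Q) * (+ 1 / 2)
          ≡⟨ rearrange (ι (d ℕ.+ 1)) (toℚ L) (ι d) (toℚ Q) ⟩
        (ι (d ℕ.+ 1) * (+ 1 / 2)) * (ι 1 - toℚ L) - toℚ L * ι d - toℚ Q
          ≡⟨ cong₂ (λ l s → (ι (d ℕ.+ 1) * (+ 1 / 2)) * (ι 1 - l) - l * ι d - s)
                   (leg3≡toℚ-legendre3 p) (Σ<-ι*Cat (suc d) (λ k → k) (λ k → d ℕ.∸ k)) ⟨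
        (ι (d ℕ.+ 1) * (+ 1 / 2)) * (ι 1 - leg3 p) - leg3 p * ι d - Σ< (suc d) (λ k → ι k * Cat (d ℕ.∸ k)) ∎
        where open ≡-Reasoning

  congruence₃ : Congruence₃ p d
  congruence₃ = subst₂ (λ a b → a ≡ b [modℚ p ]) (sym (Σ<-ι*Cat p (λ k → k ℕ.* k) (λ k → k ℕ.+ d))) rhs
                       (≈⇒≡[modℚ] p∤6 inℤ)
    where
      open +-*-Solver
      G = + (9 ℕ.* d ℕ.* d ℕ.+ 6 ℕ.* d)
      H = + ((d ℕ.+ 1) ℕ.* (d ℕ.+ 1))
      Q = Σℤ d (λ j → + (suc j ℕ.* suc j) ℤ.* catalan (d ℕ.∸ suc j))
      inℤ : + 6 ℤ.* Σℤ p (λ k → + (k ℕ.* k) ℤ.* catalan (k ℕ.+ d)) ≈ (G ℤ.- ℤ.1ℤ) ℤ.* L ℤ.- + 3 ℤ.* H ℤ.+ + 6 ℤ.* Q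
      inℤ = ≈-trans (shifted-moment₂ d<p) (+-cong (sub-cong (*-congˡ (G ℤ.- ℤ.1ℤ) euler-criterion) ≈-refl) ≈-refl)
      push : toℚ ((G ℤ.- ℤ.1ℤ) ℤ.* L ℤ.- + 3 ℤ.* H ℤ.+ + 6 ℤ.* Q) ≡ (toℚ G - ι 1) * toℚ L - ι 3 * toℚ H + ι 6 * toℚ Q
      push = trans (toℚ-homo-+ ((G ℤ.- ℤ.1ℤ) ℤ.* L ℤ.- + 3 ℤ.* H) (+ 6 ℤ.* Q))
               (cong₂ _+_ (trans (toℚ-homo-sub ((G ℤ.- ℤ.1ℤ) ℤ.* L) (+ 3 ℤ.* H))
                                 (cong₂ _-_ (trans (toℚ-homo-* (G ℤ.- ℤ.1ℤ) L) (cong (_* toℚ L) (toℚ-homo-sub G ℤ.1ℤ)))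
                                            (toℚ-homo-* (+ 3) H)))
                          (toℚ-homo-* (+ 6) Q))
      rearrange : ∀ g l η s → ((g - ι 1) * l - ι 3 * η + ι 6 * s) * (+ 1 / 6)
                              ≡ ((g - ι 1) * (+ 1 / 6)) * l - η * (+ 1 / 2) - 0ℚ + s
      rearrange = solve 4 (λ g l η s → ((g :- con (ι 1)) :* l :- con (ι 3) :* η :+ con (ι 6) :* s) :* con (+ 1 / 6)
                                      := ((g :- con (ι 1)) :* con (+ 1 / 6)) :* l :- η :* con (+ 1 / 2) :- con 0ℚ :+ s) refl
      rhs : toℚ ((G ℤ.- ℤ.1ℤ) ℤ.* L ℤ.- + 3 ℤ.* H ℤ.+ + 6 ℤ.* Q) * (+ 1 / 6)
            ≡ ((ι (9 ℕ.* d ℕ.* d ℕ.+ 6 ℕ.* d) - ι 1) * (+ 1 / 6)) * leg3 p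
              - ι ((d ℕ.+ 1) ℕ.* (d ℕ.+ 1)) * (+ 1 / 2) - isThree p
              + Σ< d (λ j → ι (suc j ℕ.* suc j) * Cat (d ℕ.∸ suc j))
      rhs = begin
        toℚ ((G ℤ.- ℤ.1ℤ) ℤ.* L ℤ.- + 3 ℤ.* H ℤ.+ + 6 ℤ.* Q) * (+ 1 / 6)
          ≡⟨ cong (_* (+ 1 / 6)) push ⟩
        ((toℚ G - ι 1) * toℚ L - ι 3 * toℚ H + ι 6 * toℚ Q) * (+ 1 / 6)
          ≡⟨ rearrange (toℚ G) (toℚ L) (toℚ H) (toℚ Q) ⟩
        ((toℚ G - ι 1) * (+ 1 / 6)) * toℚ L - toℚ H * (+ 1 / 2) - 0ℚ + toℚ Q
          ≡⟨ cong₂ (λ l t → ((toℚ G - ι 1) * (+ 1 / 6)) * l - toℚ H * (+ 1 / 2) - t + toℚ Q)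
                   (leg3≡toℚ-legendre3 p) (isThree≡0 (ℕP.>⇒≢ 3<p)) ⟨
        ((toℚ G - ι 1) * (+ 1 / 6)) * leg3 p - toℚ H * (+ 1 / 2) - isThree p + toℚ Q
          ≡⟨ cong (λ s → ((toℚ G - ι 1) * (+ 1 / 6)) * leg3 p - toℚ H * (+ 1 / 2) - isThree p + s)
                  (Σ<-ι*Cat d (λ j → suc j ℕ.* suc j) (λ j → d ℕ.∸ suc j)) ⟨
        ((toℚ G - ι 1) * (+ 1 / 6)) * leg3 p - toℚ H * (+ 1 / 2) - isThree p
          + Σ< d (λ j → ι (suc j ℕ.* suc j) * Cat (d ℕ.∸ suc j)) ∎
        where open ≡-Reasoning

data Parity : ℕ → Set where
  even : ∀ h → Parity (h ℕ.+ h)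
  odd  : ∀ h → Parity (suc (h ℕ.+ h))

parity : ∀ m → Parity m
parity zero    = even 0
parity (suc m) with parity m
... | even h = odd h
... | odd h  = subst Parity (cong suc (ℕP.+-suc h h)) (even (suc h))

prime-cases : (P : ℕ → ℕ → Set) →
  (∀ d → d < 2 → P 2 d) → (∀ d → d < 3 → P 3 d) →
  (∀ n d → Prime (suc (suc (suc n) ℕ.+ suc (suc n))) → d < suc (suc (suc n) ℕ.+ suc (suc n)) →
     P (suc (suc (suc n) ℕ.+ suc (suc n))) d) →
  ∀ p d → Prime p → d < p → P p d
prime-cases P two three odd≥5 p d isPrime d<p with parity p
... | even 0             = ⊥-elim (¬prime[0] isPrime)
... | even 1             = two d d<p
... | even (suc (suc h)) = ⊥-elim ([ (λ ()) , 2≢p ]′ (prime⇒irreducible isPrime (divides (suc (suc h)) (double (suc (suc h))))))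
  where
    double : ∀ m → m ℕ.+ m ≡ m ℕ.* 2
    double = NatSolver.solve-∀
    2≢p : 2 ≢ suc (suc h) ℕ.+ suc (suc h)
    2≢p 2≡p = ℕP.m+1+n≢0 h (sym (ℕP.suc-injective (ℕP.suc-injective 2≡p)))
... | odd 0              = ⊥-elim (¬prime[1] isPrime)
... | odd 1              = three d d<p
... | odd (suc (suc n))  = odd≥5 n d isPrime d<p

corollary1p3 : (p d : ℕ) → Prime p → d < p →
    (Σ< p (λ k → Cat (k ℕ.+ d))
       ≡ (ι 3 * leg3 p - ι 1) * (+ 1 / 2) + Σ< d (λ k → Cat k) [modℚ p ])
    × (Σ< p (λ k → ι k * Cat (k ℕ.+ d))
       ≡ (ι (d ℕ.+ 1) * (+ 1 / 2)) * (ι 1 - leg3 p) - leg3 p * ι d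
         - Σ< (suc d) (λ k → ι k * Cat (d ℕ.∸ k)) [modℚ p ])
    × (Σ< p (λ k → ι (k ℕ.* k) * Cat (k ℕ.+ d))
       ≡ ((ι (9 ℕ.* d ℕ.* d ℕ.+ 6 ℕ.* d) - ι 1) * (+ 1 / 6)) * leg3 p
         - ι ((d ℕ.+ 1) ℕ.* (d ℕ.+ 1)) * (+ 1 / 2) - isThree p
         + Σ< d (λ j → ι (suc j ℕ.* suc j) * Cat (d ℕ.∸ suc j)) [modℚ p ])
corollary1p3 p d isPrime d<p = prime-cases Congruences p=2 p=3 p≥5 p d isPrime d<p
  where
    p=2 : ∀ d → d < 2 → Congruences 2 d
    p=2 0 _ = ≡[modℚ]-by-computation , ≡[modℚ]-by-computation , ≡[modℚ]-by-computation
    p=2 1 _ = ≡[modℚ]-by-computation , ≡[modℚ]-by-computation , ≡[modℚ]-by-computation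
    p=2 (suc (suc _)) (s≤s (s≤s ()))
    p=3 : ∀ d → d < 3 → Congruences 3 d
    p=3 0 _ = ≡[modℚ]-by-computation , ≡[modℚ]-by-computation , ≡[modℚ]-by-computation
    p=3 1 _ = ≡[modℚ]-by-computation , ≡[modℚ]-by-computation , ≡[modℚ]-by-computation
    p=3 2 _ = ≡[modℚ]-by-computation , ≡[modℚ]-by-computation , ≡[modℚ]-by-computation
    p=3 (suc (suc (suc _))) (s≤s (s≤s (s≤s ())))
    p≥5 : ∀ n d → Prime (suc (suc (suc n) ℕ.+ suc (suc n))) → d < suc (suc (suc n) ℕ.+ suc (suc n)) →
          Congruences (suc (suc (suc n) ℕ.+ suc (suc n))) d
    p≥5 n d isPrime d<p = congruence₁ , congruence₂ , congruence₃
      where open PrimeAtLeast5 n isPrime d<p
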